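{- For every integer $r\ge 4$ let $\mathscr{P}_{D_r}(q)$ be the $q$-analog of Kostant's partition function evaluated at the highest root of type $D_r$ (defined in the context). Then, as formal power series in $x$ with coefficients in $\mathbb{Z}[q]$, \[ \sum_{r \geq 4} \mathscr{P}_{D_r}(q)x^r = \dfrac{(q+4q^2+6q^3+3q^4+q^5)x^4 - (q+4q^2+6q^3+5q^4+3q^5+q^6)x^5}{1-(2+2q+q^2)x+(1+2q+q^2+q^3)x^2}. \]
   Context: Type $D_r$ (the Lie algebra $\mathfrak{so}_{2r}(\mathbb{C})$), $r\ge4$: with simple roots $\alpha_1,\dots,\alpha_r$, where $\alpha_{r-2}$ is the branch node joined to $\alpha_{r-3},\alpha_{r-1},\alpha_r$, the positive roots are $\alpha_i+\alpha_{i+1}+\cdots+\alpha_j$ for $1\le i\le j\le r-1$; $\alpha_r$; $\alpha_i+\cdots+\alpha_{r-2}+\alpha_r$ for $1\le i\le r-2$; $\alpha_i+\cdots+\alpha_{r-2}+\alpha_{r-1}+\alpha_r$ for $1\le i\le r-2$; and $\alpha_i+\cdots+\alpha_{j-1}+2\alpha_j+\cdots+2\alpha_{r-2}+\alpha_{r-1}+\alpha_r$ for $1\le i<j\le r-2$. The highest root is $\tilde\alpha=\alpha_1+2\alpha_2+\cdots+2\alpha_{r-2}+\alpha_{r-1}+\alpha_r$. A partition of $\tilde\alpha$ with $k$ parts is a multiset of $k$ positive roots (repetitions allowed) summing to $\tilde\alpha$. Then $\mathscr{P}_{D_r}(q)=\sum_{k\ge1}a_kq^k$, where $a_k$ is the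 number of partitions of $\tilde\alpha$ with exactly $k$ parts. -}

module Defs where

open import Data.Nat using (ℕ; zero; suc; _+_; _*_; _∸_; _≤ᵇ_; _≟_)
open import Data.Bool using (Bool; true; false; if_then_else_; _∧_)
open import Data.List using (List; []; _∷_; map; upTo; concatMap; zipWith; replicate; filter; length; _++_)
open import Data.List.Properties using (≡-dec)
open import Data.Nat.ListAction using (sum)
open import Data.Product using (_×_)
open import Relation.Nullary.Decidable using (_×-dec_)
import Data.Integer as ℤ
open import Data.Integer using (ℤ; -_) renaming (+_ to ⁺_)

-- Roots of D_r, written in the basis of simple roots α₁,…,α_r:
-- a root is the list of its coefficients at positions 1,…,r.

range : ℕ → ℕ → List ℕ
range a b = map (a +_) (upTo (suc b ∸ a))

positions : ℕ → List ℕ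
positions r = range 1 r

mkRoot : ℕ → (ℕ → ℕ) → List ℕ
mkRoot r f = map f (positions r)

ind : ℕ → ℕ → ℕ → ℕ
ind i j p = if (i ≤ᵇ p) ∧ (p ≤ᵇ j) then 1 else 0

-- The positive roots of D_r, exactly as listed in the context:
--  (1) α_i+…+α_j                                   1 ≤ i ≤ j ≤ r-1
--  (2) α_r
--  (3) α_i+…+α_{r-2}+α_r                           1 ≤ i ≤ r-2
--  (4) α_i+…+α_{r-2}+α_{r-1}+α_r                   1 ≤ i ≤ r-2
--  (5) α_i+…+α_{j-1}+2α_j+…+2α_{r-2}+α_{r-1}+α_r   1 ≤ i < j ≤ r-2
posRoots : ℕ → List (List ℕ)
posRoots r =
     concatMap (λ i → map (λ j → mkRoot r (ind i j)) (range i (r ∸ 1))) (range 1 (r ∸ 1))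
  ++ (mkRoot r (ind r r) ∷ [])
  ++ map (λ i → mkRoot r (λ p → ind i (r ∸ 2) p + ind r r p)) (range 1 (r ∸ 2))
  ++ map (λ i → mkRoot r (λ p → ind i (r ∸ 2) p + ind (r ∸ 1) (r ∸ 1) p + ind r r p)) (range 1 (r ∸ 2))
  ++ concatMap (λ i → map (λ j → mkRoot r (λ p → ind i (j ∸ 1) p + 2 * ind j (r ∸ 2) p
                                               + ind (r ∸ 1) (r ∸ 1) p + ind r r p))
                          (range (suc i) (r ∸ 2)))
               (range 1 (r ∸ 2))

highestRoot : ℕ → List ℕ
highestRoot r = mkRoot r (λ p → ind 1 1 p + 2 * ind 2 (r ∸ 2) p + ind (r ∸ 1) (r ∸ 1) p + ind r r p)

-- A multiset of positive roots is given by its multiplicity vector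
-- m = (m_ρ)_ρ over the (duplicate-free) list posRoots r.  It has
-- k parts iff Σ m_ρ = k, and it is a partition of α̃ iff Σ m_ρ ρ = α̃.

boundedVecs : ℕ → ℕ → List (List ℕ)
boundedVecs b zero    = [] ∷ []
boundedVecs b (suc n) = concatMap (λ j → map (j ∷_) (boundedVecs b n)) (upTo (suc b))

linComb : ℕ → List ℕ → List (List ℕ) → List ℕ
linComb r []       _        = replicate r 0
linComb r (_ ∷ _)  []       = replicate r 0
linComb r (m ∷ ms) (ρ ∷ ρs) = zipWith _+_ (map (m *_) ρ) (linComb r ms ρs)

partitionsOf : ℕ → ℕ → List (List ℕ)
partitionsOf r k =
  filter (λ m → (sum m ≟ k) ×-dec ≡-dec _≟_ (linComb r m (posRoots r)) (highestRoot r))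
         (boundedVecs k (length (posRoots r)))

PCoeff : ℕ → ℕ → ℕ
PCoeff r zero    = 0
PCoeff r (suc k) = length (partitionsOf r (suc k))

-- Formal power series in x with coefficients in ℤ[q], represented by
-- their coefficient function  S r k = coefficient of x^r q^k.

Series : Set
Series = ℕ → ℕ → ℤ

Σℤ : List ℤ → ℤ
Σℤ []       = ⁺ 0
Σℤ (z ∷ zs) = z ℤ.+ Σℤ zs

_⊛_ : Series → Series → Series
(A ⊛ B) r k = Σℤ (concatMap (λ i → map (λ j → A i j ℤ.* B (r ∸ i) (k ∸ j)) (upTo (suc k)))
                            (upTo (suc r)))

-- coefficient lookup in a finite table (list of q-coefficient lists, indexed by x-power)
lookup0 : {A : Set} → A → List A → ℕ → A
lookup0 d []       _       = d
lookup0 d (a ∷ as) zero    = a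
lookup0 d (a ∷ as) (suc n) = lookup0 d as n

polySeries : List (List ℤ) → Series
polySeries t r k = lookup0 (⁺ 0) (lookup0 [] t r) k

genSeries : Series
genSeries r k = if 4 ≤ᵇ r then ⁺ PCoeff r k else ⁺ 0

numerator : Series
numerator = polySeries
  ( [] ∷ [] ∷ [] ∷ []
  ∷ (⁺ 0 ∷ ⁺ 1 ∷ ⁺ 4 ∷ ⁺ 6 ∷ ⁺ 3 ∷ ⁺ 1 ∷ [])
  ∷ (⁺ 0 ∷ - ⁺ 1 ∷ - ⁺ 4 ∷ - ⁺ 6 ∷ - ⁺ 5 ∷ - ⁺ 3 ∷ - ⁺ 1 ∷ [])
  ∷ [])

denominator : Series
denominator = polySeries
  ( (⁺ 1 ∷ [])
  ∷ (- ⁺ 2 ∷ - ⁺ 2 ∷ - ⁺ 1 ∷ [])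
  ∷ (⁺ 1 ∷ ⁺ 2 ∷ ⁺ 1 ∷ ⁺ 1 ∷ [])
  ∷ [])

module Submission where

-- Partitions are counted by a recursion `count R v k` on the list R of roots
-- (choose the multiplicity of the first root).  It agrees with the
-- enumeration of Defs and does not depend on the order of R.  Sorting the
-- roots of D_{m+4} by their α₁-coefficient (0 or 1) and peeling off the first
-- coordinate expresses the count P_m for the highest root of D_{m+4} through
-- two counts Φ_m, Γ_m in D_{m+3}.  For the q-series p_m, φ_m, γ_m = Γ_m + 1:
--   p_m = q φ_m + q γ_m,  φ_{m+1} = (1+q²) φ_m + q² γ_m,  γ_{m+1} = q φ_m + (1+2q) γ_m.
-- Cayley–Hamilton for this transfer matrix (trace 2+2q+q², determinant
-- 1+2q+q²+q³) gives p_{m+2} − (2+2q+q²) p_{m+1} + (1+2q+q²+q³) p_m = 0, so the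
-- product of the denominator with Σ_r 𝒫_{D_r} x^r vanishes in x-degrees ≥ 6;
-- degrees 4 and 5 are the explicit counts for D₄ and D₅, degrees < 4 are 0.

open import Defs
open import Data.Nat using (ℕ; suc; s≤s; z≤n)
open import Relation.Binary.PropositionalEquality using (_≡_)

-- Counting partitions of vectors into positive roots of D_r.
module Partitions where
  open import Data.Nat using (ℕ; zero; suc; _+_; _*_; _∸_; _≤ᵇ_; _≡ᵇ_; _≤_; _<_; z≤n; s≤s; _≟_; _⊓_)
  open import Data.Nat.Properties
  open import Data.Nat.ListAction using (sum)
  open import Data.Bool using (Bool; true; false; _∧_; T)
  open import Data.Bool.Properties using (T-∧; T-≡; ∧-zeroʳ; ∧-identityʳ)
  open import Data.List using (List; []; _∷_; map; upTo; applyUpTo; concatMap; zipWith; replicate; filter; length; _++_)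
  open import Data.List.Properties using (length-upTo; map-∘; map-cong; concatMap-cong; concatMap-map; map-concatMap; ++-assoc; map-++; ∷-injective; ≡-dec; length-map; length-replicate; length-zipWith; length-++; filter-++; filter-none; filter-≐)
  open import Data.List.Relation.Unary.All as All using (All) renaming ([] to []ᴬ; _∷_ to _∷ᴬ_)
  open import Data.List.Relation.Unary.All.Properties using () renaming (map⁺ to All-map⁺; ++⁺ to All-++⁺; concat⁺ to All-concat⁺)
  open import Relation.Nullary using (Dec; yes; no; does; ¬_)
  open import Relation.Nullary.Decidable using (_×-dec_)
  open import Data.Product using (_×_; _,_; proj₁; proj₂)
  open import Data.Empty using (⊥-elim)
  open import Function.Bundles using (Equivalence)
  open import Data.List.Relation.Binary.Permutation.Propositional using (_↭_; prep; swap; ↭-reflexive; module PermutationReasoning) renaming (refl to ↭-refl; trans to ↭-trans)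
  open import Data.List.Relation.Binary.Permutation.Propositional.Properties using (shift; shifts; ++⁺ˡ) renaming (++⁺ to ↭-++⁺; map⁺ to ↭-map⁺)
  open import Relation.Binary.PropositionalEquality
  open import Algebra.Properties.CommutativeSemigroup +-commutativeSemigroup using () renaming (interchange to +-interchange)

  δ : ℕ → ℕ
  δ zero    = 1
  δ (suc _) = 0

  δ-nonzero : ∀ k → ¬ (0 ≡ k) → 0 ≡ δ k
  δ-nonzero zero    ¬0≡k = ⊥-elim (¬0≡k refl)
  δ-nonzero (suc k) _    = refl

  when : Bool → ℕ → ℕ
  when true  x = x
  when false _ = 0

  when-cong : ∀ b {x y} → x ≡ y → when b x ≡ when b y
  when-cong b refl = refl

  when-zero : ∀ b {x} → x ≡ 0 → when b x ≡ 0
  when-zero true  e = e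
  when-zero false e = refl

  when-+ : ∀ b x y → when b (x + y) ≡ when b x + when b y
  when-+ true  x y = refl
  when-+ false x y = refl

  sumBelow : ℕ → (ℕ → ℕ) → ℕ
  sumBelow zero    f = 0
  sumBelow (suc n) f = f 0 + sumBelow n (λ j → f (suc j))

  sumBelow-cong : ∀ n {f g : ℕ → ℕ} → (∀ j → f j ≡ g j) → sumBelow n f ≡ sumBelow n g
  sumBelow-cong zero    e = refl
  sumBelow-cong (suc n) e = cong₂ _+_ (e 0) (sumBelow-cong n (λ j → e (suc j)))

  sumBelow-zero : ∀ n {f : ℕ → ℕ} → (∀ j → f j ≡ 0) → sumBelow n f ≡ 0
  sumBelow-zero zero    e = refl
  sumBelow-zero (suc n) e = cong₂ _+_ (e 0) (sumBelow-zero n (λ j → e (suc j)))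

  sumBelow-prefix : ∀ t n {f : ℕ → ℕ} → (∀ j → f (t + j) ≡ 0) → sumBelow (t + n) f ≡ sumBelow t f
  sumBelow-prefix zero    n     e = sumBelow-zero n e
  sumBelow-prefix (suc t) n {f} e = cong (f 0 +_) (sumBelow-prefix t n e)

  sumBelow-+ : ∀ n (f g : ℕ → ℕ) → sumBelow n (λ j → f j + g j) ≡ sumBelow n f + sumBelow n g
  sumBelow-+ zero    f g = refl
  sumBelow-+ (suc n) f g =
    trans (cong (f 0 + g 0 +_) (sumBelow-+ n (λ j → f (suc j)) (λ j → g (suc j))))
          (+-interchange (f 0) (g 0) _ _)

  sumBelow-swap : ∀ n m (G : ℕ → ℕ → ℕ) →
                  sumBelow n (λ j → sumBelow m (G j)) ≡ sumBelow m (λ l → sumBelow n (λ j → G j l))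
  sumBelow-swap zero    m G = sym (sumBelow-zero m (λ _ → refl))
  sumBelow-swap (suc n) m G =
    trans (cong (sumBelow m (G 0) +_) (sumBelow-swap n m (λ j → G (suc j))))
          (sym (sumBelow-+ m (G 0) (λ l → sumBelow n (λ j → G (suc j) l))))

  sumBelow-when : ∀ b n (g : ℕ → ℕ) → when b (sumBelow n g) ≡ sumBelow n (λ l → when b (g l))
  sumBelow-when true  n g = refl
  sumBelow-when false n g = sym (sumBelow-zero n (λ _ → refl))

  ≤ᵇ-suc : ∀ j k → (suc j ≤ᵇ suc k) ≡ (j ≤ᵇ k)
  ≤ᵇ-suc zero    k = refl
  ≤ᵇ-suc (suc j) k = refl

  sumBelow-truncate : ∀ b k (f : ℕ → ℕ) → k ≤ b → sumBelow (suc b) (λ j → when (j ≤ᵇ k) (f j)) ≡ sumBelow (suc k) f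
  sumBelow-truncate b zero f _ = sumBelow-prefix 1 b {λ j → when (j ≤ᵇ 0) (f j)} (λ _ → refl)
  sumBelow-truncate (suc b) (suc k) f (s≤s k≤b) = cong (f 0 +_)
    (trans (sumBelow-cong (suc b) (λ j → cong (λ c → when c (f (suc j))) (≤ᵇ-suc j k)))
           (sumBelow-truncate b k (λ j → f (suc j)) k≤b))

  -- Vectors of coefficients in the basis of simple roots, as lists of naturals
  -- (a shorter list is read as padded with zeros): scaling, the componentwise
  -- order, truncated difference and sum.
  zeros : ℕ → List ℕ
  zeros n = replicate n 0

  scaleV : ℕ → List ℕ → List ℕ
  scaleV j ρ = map (j *_) ρ

  leV : List ℕ → List ℕ → Bool
  leV []       v        = true
  leV (x ∷ xs) []       = (x ≡ᵇ 0) ∧ leV xs []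
  leV (x ∷ xs) (y ∷ ys) = (x ≤ᵇ y) ∧ leV xs ys

  subV : List ℕ → List ℕ → List ℕ
  subV []       a        = []
  subV (y ∷ ys) []       = y ∷ ys
  subV (y ∷ ys) (x ∷ xs) = (y ∸ x) ∷ subV ys xs

  addV : List ℕ → List ℕ → List ℕ
  addV []       b        = b
  addV (x ∷ a)  []       = x ∷ a
  addV (x ∷ a)  (y ∷ b)  = (x + y) ∷ addV a b

  isZeroV : List ℕ → Bool
  isZeroV []       = true
  isZeroV (x ∷ xs) = (x ≡ᵇ 0) ∧ isZeroV xs

  scaleV-zero : ∀ ρ → scaleV 0 ρ ≡ zeros (length ρ)
  scaleV-zero []      = refl
  scaleV-zero (x ∷ ρ) = cong (0 ∷_) (scaleV-zero ρ)

  scaleV-one : ∀ ρ → scaleV 1 ρ ≡ ρ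
  scaleV-one []      = refl
  scaleV-one (x ∷ ρ) = cong₂ _∷_ (+-identityʳ x) (scaleV-one ρ)

  scaleV-zeros : ∀ j n → scaleV j (zeros n) ≡ zeros n
  scaleV-zeros j zero    = refl
  scaleV-zeros j (suc n) = cong₂ _∷_ (*-zeroʳ j) (scaleV-zeros j n)

  leV-zeros : ∀ n v → leV (zeros n) v ≡ true
  leV-zeros zero    v       = refl
  leV-zeros (suc n) []      = leV-zeros n []
  leV-zeros (suc n) (y ∷ v) = leV-zeros n v

  subV-zeros : ∀ v n → subV v (zeros n) ≡ v
  subV-zeros []      n       = refl
  subV-zeros (y ∷ v) zero    = refl
  subV-zeros (y ∷ v) (suc n) = cong (y ∷_) (subV-zeros v n)

  leV-refl : ∀ v → leV v v ≡ true
  leV-refl []      = refl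
  leV-refl (x ∷ v) = cong₂ _∧_ (Equivalence.to T-≡ (≤⇒≤ᵇ (≤-refl {x}))) (leV-refl v)

  subV-self : ∀ v → subV v v ≡ zeros (length v)
  subV-self []      = refl
  subV-self (x ∷ v) = cong₂ _∷_ (n∸n≡0 x) (subV-self v)

  subV-nil : ∀ v → subV v [] ≡ v
  subV-nil []      = refl
  subV-nil (x ∷ v) = refl

  length-subV : ∀ v a → length (subV v a) ≡ length v
  length-subV []      a       = refl
  length-subV (y ∷ v) []      = refl
  length-subV (y ∷ v) (x ∷ a) = cong suc (length-subV v a)

  addV-comm : ∀ a b → addV a b ≡ addV b a
  addV-comm []      []      = refl
  addV-comm []      (y ∷ b) = refl
  addV-comm (x ∷ a) []      = refl
  addV-comm (x ∷ a) (y ∷ b) = cong₂ _∷_ (+-comm x y) (addV-comm a b)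

  subV-comm : ∀ v a b → subV (subV v a) b ≡ subV (subV v b) a
  subV-comm []      a       b       = refl
  subV-comm (z ∷ v) []      []      = refl
  subV-comm (z ∷ v) []      (y ∷ b) = refl
  subV-comm (z ∷ v) (x ∷ a) []      = refl
  subV-comm (z ∷ v) (x ∷ a) (y ∷ b) =
    cong₂ _∷_ (trans (∸-+-assoc z x y) (trans (cong (z ∸_) (+-comm x y)) (sym (∸-+-assoc z y x))))
              (subV-comm v a b)

  T-ext : ∀ (b c : Bool) → (T b → T c) → (T c → T b) → b ≡ c
  T-ext true  true  _ _ = refl
  T-ext true  false f _ = ⊥-elim (f _)
  T-ext false true  _ g = ⊥-elim (g _)
  T-ext false false _ _ = refl

  ≤ᵇ-split : ∀ j l k → ((j ≤ᵇ k) ∧ (l ≤ᵇ k ∸ j)) ≡ (j + l ≤ᵇ k)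
  ≤ᵇ-split j l k = T-ext _ _
    (λ t → let (j≤k , l≤k∸j) = Equivalence.to T-∧ t in
           ≤⇒≤ᵇ (subst (j + l ≤_) (m+[n∸m]≡n (≤ᵇ⇒≤ j k j≤k)) (+-monoʳ-≤ j (≤ᵇ⇒≤ l (k ∸ j) l≤k∸j))))
    (λ t → let j+l≤k = ≤ᵇ⇒≤ (j + l) k t in
           Equivalence.from T-∧ (≤⇒≤ᵇ (m+n≤o⇒m≤o j j+l≤k) ,
                                 ≤⇒≤ᵇ (subst (_≤ k ∸ j) (m+n∸m≡n j l) (∸-monoˡ-≤ j j+l≤k))))

  ≡ᵇ0-+ : ∀ x y → ((x + y) ≡ᵇ 0) ≡ ((x ≡ᵇ 0) ∧ (y ≡ᵇ 0))
  ≡ᵇ0-+ zero    y = refl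
  ≡ᵇ0-+ (suc x) y = refl

  ∧-interchange : ∀ p q r s → ((p ∧ q) ∧ (r ∧ s)) ≡ ((p ∧ r) ∧ (q ∧ s))
  ∧-interchange true  true  r     s = refl
  ∧-interchange true  false true  s = refl
  ∧-interchange true  false false s = refl
  ∧-interchange false q     r     s = refl

  leV-addV : ∀ a b v → (leV a v ∧ leV b (subV v a)) ≡ leV (addV a b) v
  leV-addV []      b       v       = cong (leV b) (subV-nil v)
  leV-addV (x ∷ a) []      v       = ∧-identityʳ _
  leV-addV (x ∷ a) (y ∷ b) []      =
    trans (∧-interchange (x ≡ᵇ 0) (leV a []) (y ≡ᵇ 0) (leV b []))
          (cong₂ _∧_ (sym (≡ᵇ0-+ x y)) (leV-addV a b []))
  leV-addV (x ∷ a) (y ∷ b) (z ∷ v) =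
    trans (∧-interchange (x ≤ᵇ z) (leV a v) (y ≤ᵇ z ∸ x) (leV b (subV v a)))
          (cong₂ _∧_ (≤ᵇ-split x y z) (leV-addV a b v))

  sum-subV : ∀ v a → leV a v ≡ true → sum (subV v a) + sum a ≡ sum v
  sum-subV v       []      _ = trans (+-identityʳ _) (cong sum (subV-nil v))
  sum-subV []      (zero ∷ a) e = sum-subV [] a e
  sum-subV (z ∷ v) (x ∷ a) e with x ≤ᵇ z in x≤z
  sum-subV (z ∷ v) (x ∷ a) e | true =
    trans (+-interchange (z ∸ x) (sum (subV v a)) x (sum a))
          (cong₂ _+_ (m∸n+n≡m (≤ᵇ⇒≤ x z (subst T (sym x≤z) _))) (sum-subV v a e))

  sum-scaleV : ∀ j ρ → sum (scaleV j ρ) ≡ j * sum ρ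
  sum-scaleV j []      = sym (*-zeroʳ j)
  sum-scaleV j (x ∷ ρ) = trans (cong (j * x +_) (sum-scaleV j ρ)) (sym (*-distribˡ-+ j x (sum ρ)))

  -- count R v k: the number of multisets of exactly k members of the list R
  -- (i.e. multiplicity vectors (m_ρ)_{ρ ∈ R} with Σ m_ρ = k) whose sum is v.
  mutual
    count : List (List ℕ) → List ℕ → ℕ → ℕ
    count []      v k = when (isZeroV v) (δ k)
    count (ρ ∷ R) v k = sumBelow (suc k) (countUsing ρ R v k)

    countUsing : List ℕ → List (List ℕ) → List ℕ → ℕ → ℕ → ℕ
    countUsing ρ R v k j = when (leV (scaleV j ρ) v) (count R (subV v (scaleV j ρ)) (k ∸ j))

  countUsing-zero : ∀ ρ R v k → countUsing ρ R v k 0 ≡ count R v k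
  countUsing-zero ρ R v k
    rewrite scaleV-zero ρ | leV-zeros (length ρ) v | subV-zeros v (length ρ) = refl

  countUsing-one : ∀ ρ R v k → countUsing ρ R v k 1 ≡ when (leV ρ v) (count R (subV v ρ) (k ∸ 1))
  countUsing-one ρ R v k rewrite scaleV-one ρ = refl

  count-atMost : ∀ t ρ R v n → (∀ j → countUsing ρ R v (t + n) (suc t + j) ≡ 0) →
                 count (ρ ∷ R) v (t + n) ≡ sumBelow (suc t) (countUsing ρ R v (t + n))
  count-atMost t ρ R v n = sumBelow-prefix (suc t) n {countUsing ρ R v (t + n)}

  count-empty : ∀ R v → count R v 0 ≡ when (isZeroV v) 1
  count-empty []      v = refl
  count-empty (ρ ∷ R) v = trans (+-identityʳ _) (trans (countUsing-zero ρ R v 0) (count-empty R v))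

  count-height : ∀ R → All (λ ρ → 1 ≤ sum ρ) R → ∀ v k → sum v < k → count R v k ≡ 0
  count-height []      _           v (suc k) _  = when-zero (isZeroV v) refl
  count-height (ρ ∷ R) (hρ ∷ᴬ hR) v k     lt = sumBelow-zero (suc k) term
    where
    term : ∀ j → countUsing ρ R v k j ≡ 0
    term j with leV (scaleV j ρ) v in fits
    ... | false = refl
    ... | true  = count-height R hR (subV v (scaleV j ρ)) (k ∸ j)
        (m+n≤o⇒m≤o∸n (suc (sum (subV v (scaleV j ρ)))) {j} {k}
          (≤-trans (s≤s (+-monoʳ-≤ (sum (subV v (scaleV j ρ))) j≤height))
                   (subst (λ z → suc z ≤ k) (sym (sum-subV v (scaleV j ρ) fits)) lt)))
      where
      j≤height : j ≤ sum (scaleV j ρ)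
      j≤height = subst (j ≤_) (sym (sum-scaleV j ρ))
                       (subst (_≤ j * sum ρ) (*-identityʳ j) (*-monoʳ-≤ j hρ))

  module _ {A : Set} {P : A → Set} (P? : ∀ x → Dec (P x)) where

    length-filter-∷ : ∀ x xs → length (filter P? (x ∷ xs)) ≡ when (does (P? x)) 1 + length (filter P? xs)
    length-filter-∷ x xs with does (P? x)
    ... | true  = refl
    ... | false = refl

    length-filter-none : (∀ x → ¬ P x) → ∀ xs → length (filter P? xs) ≡ 0
    length-filter-none ¬P xs = cong length (filter-none P? (All.universal ¬P xs))

    length-filter-concatMap : ∀ (f : ℕ → List A) (g : ℕ → ℕ) n →
      length (filter P? (concatMap f (applyUpTo g n))) ≡ sumBelow n (λ i → length (filter P? (f (g i))))
    length-filter-concatMap f g zero    = refl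
    length-filter-concatMap f g (suc n) =
      trans (cong length (filter-++ P? (f (g 0)) _))
            (trans (length-++ (filter P? (f (g 0))))
                   (cong (length (filter P? (f (g 0))) +_) (length-filter-concatMap f (λ i → g (suc i)) n)))

  length-filter-map : ∀ {A B : Set} {P : B → Set} (P? : ∀ x → Dec (P x)) (f : A → B) xs →
    length (filter P? (map f xs)) ≡ length (filter (λ x → P? (f x)) xs)
  length-filter-map P? f []       = refl
  length-filter-map P? f (x ∷ xs) =
    trans (length-filter-∷ P? (f x) (map f xs))
          (trans (cong (_ +_) (length-filter-map P? f xs)) (sym (length-filter-∷ (λ x → P? (f x)) x xs)))

  zipWith-+-split : ∀ a L v → length a ≡ length v → length L ≡ length v →
                    zipWith _+_ a L ≡ v → T (leV a v) × (L ≡ subV v a)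
  zipWith-+-split []      []      []      _  _  _ = _ , refl
  zipWith-+-split (x ∷ a) (y ∷ L) (z ∷ v) la lL e
    with (x+y≡z , e′) ← ∷-injective e
    with (a≤v , L≡v-a) ← zipWith-+-split a L v (suc-injective la) (suc-injective lL) e′ =
      Equivalence.from T-∧ (≤⇒≤ᵇ (subst (x ≤_) x+y≡z (m≤m+n x y)) , a≤v) ,
      cong₂ _∷_ (trans (sym (m+n∸m≡n x y)) (cong (_∸ x) x+y≡z)) L≡v-a

  zipWith-+-merge : ∀ a L v → length a ≡ length v → length L ≡ length v →
                    T (leV a v) → L ≡ subV v a → zipWith _+_ a L ≡ v
  zipWith-+-merge []      []      []      _  _  _ _     = refl
  zipWith-+-merge (x ∷ a) (y ∷ L) (z ∷ v) la lL t refl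
    with (x≤z , a≤v) ← Equivalence.to T-∧ t =
      cong₂ _∷_ (m+[n∸m]≡n (≤ᵇ⇒≤ x z x≤z))
                (zipWith-+-merge a L v (suc-injective la) (suc-injective lL) a≤v refl)

  IsPartition : ℕ → List (List ℕ) → List ℕ → ℕ → List ℕ → Set
  IsPartition r R v k m = (sum m ≡ k) × (linComb r m R ≡ v)

  isPartition? : ∀ r R v k m → Dec (IsPartition r R v k m)
  isPartition? r R v k m = (sum m ≟ k) ×-dec ≡-dec _≟_ (linComb r m R) v

  length-linComb : ∀ r m R → All (λ ρ → length ρ ≡ r) R → length (linComb r m R) ≡ r
  length-linComb r []      R        _           = length-replicate r
  length-linComb r (j ∷ m) []       _           = length-replicate r
  length-linComb r (j ∷ m) (ρ ∷ R) (lρ ∷ᴬ lR) =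
    trans (length-zipWith _+_ (map (j *_) ρ) (linComb r m R))
          (trans (cong₂ _⊓_ (trans (length-map (j *_) ρ) lρ) (length-linComb r m R lR)) (⊓-idem r))

  isZeroV-zeros : ∀ n → isZeroV (zeros n) ≡ true
  isZeroV-zeros zero    = refl
  isZeroV-zeros (suc n) = isZeroV-zeros n

  isZeroV-true : ∀ v → isZeroV v ≡ true → v ≡ zeros (length v)
  isZeroV-true []         _ = refl
  isZeroV-true (zero ∷ v) e = cong (0 ∷_) (isZeroV-true v e)

  enumerate-nil : ∀ r v k → length v ≡ r →
                  length (filter (isPartition? r [] v k) ([] ∷ [])) ≡ count [] v k
  enumerate-nil r v k lv = trans (length-filter-∷ (isPartition? r [] v k) [] []) (decide (isPartition? r [] v k []))
    where
    decide : (d : Dec (IsPartition r [] v k [])) → when (does d) 1 + 0 ≡ when (isZeroV v) (δ k)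
    decide (yes (refl , refl)) rewrite isZeroV-zeros r = refl
    decide (no ¬p) with isZeroV v in zero-v
    ... | false = refl
    ... | true  = δ-nonzero k (λ 0≡k → ¬p (0≡k , sym (trans (isZeroV-true v zero-v) (cong zeros lv))))

  enumerate-first : ∀ r ρ R v b k j → length ρ ≡ r → All (λ σ → length σ ≡ r) R → length v ≡ r →
    (∀ v′ k′ → length v′ ≡ r → k′ ≤ b → length (filter (isPartition? r R v′ k′) (boundedVecs b (length R))) ≡ count R v′ k′) →
    k ≤ b → length (filter (λ m → isPartition? r (ρ ∷ R) v k (j ∷ m)) (boundedVecs b (length R)))
            ≡ when (j ≤ᵇ k) (countUsing ρ R v k j)
  enumerate-first r ρ R v b k j lρ lR lv enumR k≤b with j ≤ᵇ k in j≤k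
  ... | false = length-filter-none (λ m → isPartition? r (ρ ∷ R) v k (j ∷ m))
        (λ m p → subst T j≤k (≤⇒≤ᵇ (subst (j ≤_) (proj₁ p) (m≤m+n j (sum m))))) (boundedVecs b (length R))
  ... | true with leV (scaleV j ρ) v in fits
  ...   | false = length-filter-none (λ m → isPartition? r (ρ ∷ R) v k (j ∷ m))
          (λ m p → subst T fits (proj₁ (zipWith-+-split (scaleV j ρ) (linComb r m R) v
                                           (trans (length-map _ ρ) (trans lρ (sym lv)))
                                           (trans (length-linComb r m R lR) (sym lv)) (proj₂ p)))) (boundedVecs b (length R))
  ...   | true = trans (cong length (filter-≐ (λ m → isPartition? r (ρ ∷ R) v k (j ∷ m))
                                                 (isPartition? r R (subV v (scaleV j ρ)) (k ∸ j))
                                                 ((λ {m} → split {m}) , (λ {m} → merge {m})) (boundedVecs b (length R))))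
                       (enumR _ (k ∸ j) (trans (length-subV v (scaleV j ρ)) lv) (≤-trans (m∸n≤m k j) k≤b))
    where
    lj : length (scaleV j ρ) ≡ length v
    lj = trans (length-map _ ρ) (trans lρ (sym lv))
    lm : ∀ m → length (linComb r m R) ≡ length v
    lm m = trans (length-linComb r m R lR) (sym lv)
    split : ∀ {m} → IsPartition r (ρ ∷ R) v k (j ∷ m) → IsPartition r R (subV v (scaleV j ρ)) (k ∸ j) m
    split {m} (size , total) =
      trans (sym (m+n∸m≡n j (sum m))) (cong (_∸ j) size) ,
      proj₂ (zipWith-+-split (scaleV j ρ) (linComb r m R) v lj (lm m) total)
    merge : ∀ {m} → IsPartition r R (subV v (scaleV j ρ)) (k ∸ j) m → IsPartition r (ρ ∷ R) v k (j ∷ m)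
    merge {m} (size , total) =
      trans (cong (j +_) size) (m+[n∸m]≡n (≤ᵇ⇒≤ j k (subst T (sym j≤k) _))) ,
      zipWith-+-merge (scaleV j ρ) (linComb r m R) v lj (lm m) (subst T (sym fits) _) total

  enumerate-count : ∀ r R v b k → All (λ ρ → length ρ ≡ r) R → length v ≡ r → k ≤ b →
    length (filter (isPartition? r R v k) (boundedVecs b (length R))) ≡ count R v k
  enumerate-count r []      v b k _           lv _   = enumerate-nil r v k lv
  enumerate-count r (ρ ∷ R) v b k (lρ ∷ᴬ lR) lv k≤b =
    begin
      length (filter P? (concatMap (λ j → map (j ∷_) BV) (upTo (suc b))))
    ≡⟨ length-filter-concatMap P? (λ j → map (j ∷_) BV) (λ j → j) (suc b) ⟩
      sumBelow (suc b) (λ j → length (filter P? (map (j ∷_) BV)))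
    ≡⟨ sumBelow-cong (suc b) (λ j → trans (length-filter-map P? (j ∷_) BV)
                                          (enumerate-first r ρ R v b k j lρ lR lv enumR k≤b)) ⟩
      sumBelow (suc b) (λ j → when (j ≤ᵇ k) (countUsing ρ R v k j))
    ≡⟨ sumBelow-truncate b k (countUsing ρ R v k) k≤b ⟩
      count (ρ ∷ R) v k
    ∎
    where
    open ≡-Reasoning
    P? = isPartition? r (ρ ∷ R) v k
    BV = boundedVecs b (length R)
    enumR : ∀ v′ k′ → length v′ ≡ r → k′ ≤ b → length (filter (isPartition? r R v′ k′) BV) ≡ count R v′ k′
    enumR v′ k′ lv′ k′≤b = enumerate-count r R v′ b k′ lR lv′ k′≤b

  -- count with one fixed range {0..b} (b ≥ k) for every multiplicity; the
  -- uniform range makes the independence of the order of the roots visible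
  countB : ℕ → List (List ℕ) → List ℕ → ℕ → ℕ
  countB b []      v k = count [] v k
  countB b (ρ ∷ R) v k =
    sumBelow (suc b) (λ j → when (j ≤ᵇ k) (when (leV (scaleV j ρ) v) (countB b R (subV v (scaleV j ρ)) (k ∸ j))))

  count≡countB : ∀ R b v k → k ≤ b → count R v k ≡ countB b R v k
  count≡countB []      b v k _   = refl
  count≡countB (ρ ∷ R) b v k k≤b =
    trans (sym (sumBelow-truncate b k (countUsing ρ R v k) k≤b))
          (sumBelow-cong (suc b) (λ j → when-cong (j ≤ᵇ k) (when-cong (leV (scaleV j ρ) v)
            (count≡countB R b (subV v (scaleV j ρ)) (k ∸ j) (≤-trans (m∸n≤m k j) k≤b)))))

  when-nest : ∀ a b c d x → when a (when b (when c (when d x))) ≡ when ((a ∧ c) ∧ (b ∧ d)) x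
  when-nest true  true  true  d x = refl
  when-nest true  true  false d x = refl
  when-nest true  false true  d x = refl
  when-nest true  false false d x = refl
  when-nest false b     c     d x = refl

  usable-pair : ∀ j l k a b v →
    ((j ≤ᵇ k) ∧ (l ≤ᵇ k ∸ j)) ∧ (leV a v ∧ leV b (subV v a)) ≡ (j + l ≤ᵇ k) ∧ leV (addV a b) v
  usable-pair j l k a b v = cong₂ _∧_ (≤ᵇ-split j l k) (leV-addV a b v)

  countB-swap : ∀ b ρ σ R v k → countB b (ρ ∷ σ ∷ R) v k ≡ countB b (σ ∷ ρ ∷ R) v k
  countB-swap b ρ σ R v k =
    begin
      countB b (ρ ∷ σ ∷ R) v k
    ≡⟨ double ρ σ ⟩
      sumBelow (suc b) (λ j → sumBelow (suc b) (λ l → term ρ σ j l))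
    ≡⟨ sumBelow-swap (suc b) (suc b) (term ρ σ) ⟩
      sumBelow (suc b) (λ l → sumBelow (suc b) (λ j → term ρ σ j l))
    ≡⟨ sumBelow-cong (suc b) (λ l → sumBelow-cong (suc b) (λ j → term-symmetric j l)) ⟩
      sumBelow (suc b) (λ l → sumBelow (suc b) (λ j → term σ ρ l j))
    ≡⟨ double σ ρ ⟨
      countB b (σ ∷ ρ ∷ R) v k
    ∎
    where
    open ≡-Reasoning
    rest : List ℕ → List ℕ → ℕ → ℕ → ℕ
    rest ρ σ j l = countB b R (subV (subV v (scaleV j ρ)) (scaleV l σ)) (k ∸ j ∸ l)
    inner : List ℕ → List ℕ → ℕ → ℕ → ℕ
    inner ρ σ j l = when (l ≤ᵇ k ∸ j) (when (leV (scaleV l σ) (subV v (scaleV j ρ))) (rest ρ σ j l))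
    term : List ℕ → List ℕ → ℕ → ℕ → ℕ
    term ρ σ j l = when (j ≤ᵇ k) (when (leV (scaleV j ρ) v) (inner ρ σ j l))
    usable : List ℕ → List ℕ → ℕ → ℕ → Bool
    usable ρ σ j l = ((j ≤ᵇ k) ∧ (l ≤ᵇ k ∸ j)) ∧ (leV (scaleV j ρ) v ∧ leV (scaleV l σ) (subV v (scaleV j ρ)))

    double : ∀ ρ σ → countB b (ρ ∷ σ ∷ R) v k ≡ sumBelow (suc b) (λ j → sumBelow (suc b) (λ l → term ρ σ j l))
    double ρ σ = sumBelow-cong (suc b) (λ j →
      trans (when-cong (j ≤ᵇ k) (sumBelow-when (leV (scaleV j ρ) v) (suc b) (inner ρ σ j)))
            (sumBelow-when (j ≤ᵇ k) (suc b) (λ l → when (leV (scaleV j ρ) v) (inner ρ σ j l))))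

    term-normal : ∀ ρ σ j l → term ρ σ j l ≡ when (usable ρ σ j l) (rest ρ σ j l)
    term-normal ρ σ j l =
      when-nest (j ≤ᵇ k) (leV (scaleV j ρ) v) (l ≤ᵇ k ∸ j) (leV (scaleV l σ) (subV v (scaleV j ρ))) (rest ρ σ j l)

    usable-symmetric : ∀ j l → usable ρ σ j l ≡ usable σ ρ l j
    usable-symmetric j l =
      trans (usable-pair j l k (scaleV j ρ) (scaleV l σ) v)
            (trans (cong₂ (λ n w → (n ≤ᵇ k) ∧ leV w v) (+-comm j l) (addV-comm (scaleV j ρ) (scaleV l σ)))
                   (sym (usable-pair l j k (scaleV l σ) (scaleV j ρ) v)))

    rest-symmetric : ∀ j l → rest ρ σ j l ≡ rest σ ρ l j
    rest-symmetric j l =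
      cong₂ (countB b R) (subV-comm v (scaleV j ρ) (scaleV l σ))
                         (trans (∸-+-assoc k j l) (trans (cong (k ∸_) (+-comm j l)) (sym (∸-+-assoc k l j))))

    term-symmetric : ∀ j l → term ρ σ j l ≡ term σ ρ l j
    term-symmetric j l =
      trans (term-normal ρ σ j l)
            (trans (cong₂ when (usable-symmetric j l) (rest-symmetric j l)) (sym (term-normal σ ρ l j)))

  countB-cons : ∀ b ρ {R S} → (∀ v k → countB b R v k ≡ countB b S v k) →
                ∀ v k → countB b (ρ ∷ R) v k ≡ countB b (ρ ∷ S) v k
  countB-cons b ρ e v k = sumBelow-cong (suc b) (λ j → when-cong (j ≤ᵇ k) (when-cong (leV (scaleV j ρ) v) (e (subV v (scaleV j ρ)) (k ∸ j))))

  countB-perm : ∀ {R S} → R ↭ S → ∀ b v k → countB b R v k ≡ countB b S v k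
  countB-perm ↭-refl            b v k = refl
  countB-perm (prep {xs} {ys} ρ R↭S)   b v k = countB-cons b ρ {xs} {ys} (countB-perm R↭S b) v k
  countB-perm (swap {xs} {ys} ρ σ R↭S) b v k =
    trans (countB-swap b ρ σ xs v k)
          (countB-cons b σ {ρ ∷ xs} {ρ ∷ ys} (countB-cons b ρ {xs} {ys} (countB-perm R↭S b)) v k)
  countB-perm (↭-trans R↭S S↭T) b v k = trans (countB-perm R↭S b v k) (countB-perm S↭T b v k)

  count-perm : ∀ {R S} → R ↭ S → ∀ v k → count R v k ≡ count S v k
  count-perm {R} {S} R↭S v k =
    trans (count≡countB R k v k ≤-refl) (trans (countB-perm R↭S k v k) (sym (count≡countB S k v k ≤-refl)))

  count-unused : ∀ ρ R v k → (∀ j → countUsing ρ R v k (suc j) ≡ 0) → count (ρ ∷ R) v k ≡ count R v k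
  count-unused ρ R v k unused =
    trans (count-atMost 0 ρ R v k unused) (trans (+-identityʳ _) (countUsing-zero ρ R v k))

  sumOver : List (List ℕ) → (List ℕ → ℕ) → ℕ
  sumOver []       f = 0
  sumOver (x ∷ xs) f = f x + sumOver xs f

  sumOver-cong : ∀ xs {f g : List ℕ → ℕ} → (∀ x → f x ≡ g x) → sumOver xs f ≡ sumOver xs g
  sumOver-cong []       e = refl
  sumOver-cong (x ∷ xs) e = cong₂ _+_ (e x) (sumOver-cong xs e)

  sumOver-zero : ∀ xs {f : List ℕ → ℕ} → (∀ x → f x ≡ 0) → sumOver xs f ≡ 0
  sumOver-zero []       e = refl
  sumOver-zero (x ∷ xs) e = cong₂ _+_ (e x) (sumOver-zero xs e)

  sumOver-+ : ∀ xs (f g : List ℕ → ℕ) → sumOver xs (λ x → f x + g x) ≡ sumOver xs f + sumOver xs g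
  sumOver-+ []       f g = refl
  sumOver-+ (x ∷ xs) f g =
    trans (cong (f x + g x +_) (sumOver-+ xs f g)) (+-interchange (f x) (g x) (sumOver xs f) (sumOver xs g))

  sumOver-map : ∀ (g : List ℕ → List ℕ) xs (f : List ℕ → ℕ) → sumOver (map g xs) f ≡ sumOver xs (λ x → f (g x))
  sumOver-map g []       f = refl
  sumOver-map g (x ∷ xs) f = cong (f (g x) +_) (sumOver-map g xs f)

  -- Peeling off the first coordinate.  `layered R B` lists the roots with
  -- first coordinate 1 and tail in R, then those with first coordinate 0 and
  -- tail in B; every root system below has this shape with respect to α₁.
  layered : List (List ℕ) → List (List ℕ) → List (List ℕ)
  layered R B = map (1 ∷_) R ++ map (0 ∷_) B

  count-lead-0 : ∀ B v k → count (map (0 ∷_) B) (0 ∷ v) k ≡ count B v k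
  count-lead-0 []      v k = refl
  count-lead-0 (β ∷ B) v k = sumBelow-cong (suc k) term
    where
    term : ∀ j → countUsing (0 ∷ β) (map (0 ∷_) B) (0 ∷ v) k j ≡ countUsing β B v k j
    term j rewrite *-zeroʳ j = when-cong (leV (scaleV j β) v) (count-lead-0 B (subV v (scaleV j β)) (k ∸ j))

  count-lead-0-pos : ∀ B c v k → count (map (0 ∷_) B) (suc c ∷ v) k ≡ 0
  count-lead-0-pos []      c v k = refl
  count-lead-0-pos (β ∷ B) c v k = sumBelow-zero (suc k) term
    where
    term : ∀ j → countUsing (0 ∷ β) (map (0 ∷_) B) (suc c ∷ v) k j ≡ 0
    term j rewrite *-zeroʳ j = when-zero (leV (scaleV j β) v) (count-lead-0-pos B c (subV v (scaleV j β)) (k ∸ j))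

  count-layered-0 : ∀ R B v k → count (layered R B) (0 ∷ v) k ≡ count B v k
  count-layered-0 []      B v k = count-lead-0 B v k
  count-layered-0 (τ ∷ R) B v k =
    trans (count-unused (1 ∷ τ) (layered R B) (0 ∷ v) k (λ _ → refl)) (count-layered-0 R B v k)

  count-layered-1 : ∀ R B v k → count (layered R B) (1 ∷ v) (suc k)
                                ≡ sumOver R (λ τ → when (leV τ v) (count B (subV v τ) k))
  count-layered-1 []      B v k = count-lead-0-pos B 0 v (suc k)
  count-layered-1 (τ ∷ R) B v k =
    begin
      count (layered (τ ∷ R) B) (1 ∷ v) (suc k)
    ≡⟨ count-atMost 1 (1 ∷ τ) (layered R B) (1 ∷ v) k (λ _ → refl) ⟩
      countUsing (1 ∷ τ) (layered R B) (1 ∷ v) (suc k) 0 + (countUsing (1 ∷ τ) (layered R B) (1 ∷ v) (suc k) 1 + 0)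
    ≡⟨ cong₂ _+_ (trans (countUsing-zero (1 ∷ τ) (layered R B) (1 ∷ v) (suc k)) (count-layered-1 R B v k))
                 (trans (+-identityʳ _) (trans (countUsing-one (1 ∷ τ) (layered R B) (1 ∷ v) (suc k))
                                               (when-cong (leV τ v) (count-layered-0 R B (subV v τ) k)))) ⟩
      sumOver R remainder + remainder τ
    ≡⟨ +-comm (sumOver R remainder) (remainder τ) ⟩
      sumOver (τ ∷ R) remainder
    ∎
    where
    open ≡-Reasoning
    remainder : List ℕ → ℕ
    remainder τ = when (leV τ v) (count B (subV v τ) k)

  -- If the first two coordinates of the target agree, then a root with
  -- leading coordinates (1,0) is never usable and those with (0,1) cannot be
  -- compensated, so both kinds can be discarded and the first coordinate merged.
  count-equal-leads : ∀ R₁ R₂ B c v k →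
    count (layered (map (1 ∷_) R₁) (layered R₂ B)) (c ∷ c ∷ v) k ≡ count (layered R₁ B) (c ∷ v) k
  count-equal-leads []       R₂ B zero    v k =
    trans (count-lead-0 (layered R₂ B) (0 ∷ v) k) (trans (count-layered-0 R₂ B v k) (sym (count-lead-0 B v k)))
  count-equal-leads []       R₂ B (suc c) v k =
    trans (count-lead-0-pos (layered R₂ B) c (suc c ∷ v) k) (sym (count-lead-0-pos B c v k))
  count-equal-leads (τ ∷ R₁) R₂ B c       v k = sumBelow-cong (suc k) term
    where
    term : ∀ j → countUsing (1 ∷ 1 ∷ τ) (layered (map (1 ∷_) R₁) (layered R₂ B)) (c ∷ c ∷ v) k j
               ≡ countUsing (1 ∷ τ) (layered R₁ B) (c ∷ v) k j
    term j with j * 1 ≤ᵇ c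
    ... | true  = when-cong (leV (scaleV j τ) v) (count-equal-leads R₁ R₂ B (c ∸ j * 1) (subV v (scaleV j τ)) (k ∸ j))
    ... | false = refl

  ind-suc : ∀ i j p → ind (suc i) (suc j) (suc p) ≡ ind i j p
  ind-suc i j p rewrite ≤ᵇ-suc i p | ≤ᵇ-suc p j = refl

  ind-1-suc : ∀ j p → ind 1 (suc j) (suc (suc p)) ≡ ind 1 j (suc p)
  ind-1-suc j p rewrite ≤ᵇ-suc (suc p) j = refl

  map-applyUpTo : ∀ {A B : Set} (f : A → B) (g : ℕ → A) n → map f (applyUpTo g n) ≡ applyUpTo (λ i → f (g i)) n
  map-applyUpTo f g zero    = refl
  map-applyUpTo f g (suc n) = cong (f (g 0) ∷_) (map-applyUpTo f (λ i → g (suc i)) n)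

  range-1-suc : ∀ n → range 1 (suc n) ≡ 1 ∷ map suc (range 1 n)
  range-1-suc n = cong (1 ∷_) (trans (map-applyUpTo (1 +_) suc n)
    (sym (trans (cong (map suc) (map-applyUpTo (1 +_) (λ i → i) n)) (map-applyUpTo suc (λ i → suc i) n))))

  range-suc : ∀ i n → range (suc i) (suc n) ≡ map suc (range i n)
  range-suc i n = map-∘ {g = suc} {f = i +_} (upTo (suc n ∸ i))

  mkRoot-suc : ∀ n f → mkRoot (suc n) f ≡ f 1 ∷ mkRoot n (λ p → f (suc p))
  mkRoot-suc n f = trans (cong (map f) (range-1-suc n)) (cong (f 1 ∷_) (sym (map-∘ {g = f} {f = suc} (range 1 n))))

  mkRoot-cong : ∀ n f g → (∀ p → f (suc p) ≡ g (suc p)) → mkRoot n f ≡ mkRoot n g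
  mkRoot-cong n f g e =
    trans (sym (map-∘ {g = f} {f = suc} (upTo n))) (trans (map-cong e (upTo n)) (map-∘ {g = g} {f = suc} (upTo n)))

  mkRoot-0 : ∀ n → mkRoot n (λ _ → 0) ≡ zeros n
  mkRoot-0 zero    = refl
  mkRoot-0 (suc n) = trans (mkRoot-suc n (λ _ → 0)) (cong (0 ∷_) (mkRoot-0 n))

  -- (2,…,2,1,1) with m twos: the highest root of D_{m+4} is 1 ∷ highTail (m+1),
  -- and highTail m itself is 2α₁+…+2α_m+α_{m+1}+α_{m+2} in D_{m+2}.
  highTail : ℕ → List ℕ
  highTail m = replicate m 2 ++ 1 ∷ 1 ∷ []

  highTail-mkRoot : ∀ t → mkRoot (suc (suc t)) (λ q → 2 * ind 1 t q + ind (suc t) (suc t) q + ind (suc (suc t)) (suc (suc t)) q)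
                          ≡ highTail t
  highTail-mkRoot zero    = refl
  highTail-mkRoot (suc t) = trans (mkRoot-suc (suc (suc t)) _) (cong (2 ∷_)
    (trans (mkRoot-cong (suc (suc t)) _ _ (λ p → cong₂ _+_ (cong₂ _+_ (cong (2 *_) (ind-1-suc t p)) (ind-suc (suc t) (suc t) (suc p)))
                                                           (ind-suc (suc (suc t)) (suc (suc t)) (suc p))))
           (highTail-mkRoot t)))

  length-highTail : ∀ m → length (highTail m) ≡ suc (suc m)
  length-highTail zero    = refl
  length-highTail (suc m) = cong suc (length-highTail m)

  family₁ family₂ family₃ family₄ family₅ : ℕ → List (List ℕ)
  family₁ r = concatMap (λ i → map (λ j → mkRoot r (ind i j)) (range i (r ∸ 1))) (range 1 (r ∸ 1))
  family₂ r = mkRoot r (ind r r) ∷ []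
  family₃ r = map (λ i → mkRoot r (λ p → ind i (r ∸ 2) p + ind r r p)) (range 1 (r ∸ 2))
  family₄ r = map (λ i → mkRoot r (λ p → ind i (r ∸ 2) p + ind (r ∸ 1) (r ∸ 1) p + ind r r p)) (range 1 (r ∸ 2))
  family₅ r = concatMap (λ i → map (λ j → mkRoot r (λ p → ind i (j ∸ 1) p + 2 * ind j (r ∸ 2) p
                                                      + ind (r ∸ 1) (r ∸ 1) p + ind r r p))
                                   (range (suc i) (r ∸ 2)))
                        (range 1 (r ∸ 2))

  lead₁ : ℕ → List (List ℕ)
  lead₁ r = map (λ j → mkRoot r (ind 1 j)) (range 1 (r ∸ 1))

  lead₃ lead₄ : ℕ → List ℕ
  lead₃ r = mkRoot r (λ p → ind 1 (r ∸ 2) p + ind r r p)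
  lead₄ r = mkRoot r (λ p → ind 1 (r ∸ 2) p + ind (r ∸ 1) (r ∸ 1) p + ind r r p)

  lead₅ : ℕ → List (List ℕ)
  lead₅ r = map (λ j → mkRoot r (λ p → ind 1 (j ∸ 1) p + 2 * ind j (r ∸ 2) p + ind (r ∸ 1) (r ∸ 1) p + ind r r p))
                (range 2 (r ∸ 2))

  leadRoots : ℕ → List (List ℕ)
  leadRoots r = lead₁ r ++ lead₃ r ∷ lead₄ r ∷ lead₅ r

  map-suc-shift : ∀ (f f′ : ℕ → List ℕ) c xs → (∀ j → f (suc j) ≡ c ∷ f′ j) →
                  map f (map suc xs) ≡ map (c ∷_) (map f′ xs)
  map-suc-shift f f′ c xs e = trans (sym (map-∘ xs)) (trans (map-cong e xs) (map-∘ xs))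

  map-suc-shift⁺ : ∀ (f f′ : ℕ → List ℕ) c t → (∀ x → f (suc (suc x)) ≡ c ∷ f′ (suc x)) →
                   map f (map suc (range 1 t)) ≡ map (c ∷_) (map f′ (range 1 t))
  map-suc-shift⁺ f f′ c t e =
    trans (sym (map-∘ (range 1 t))) (trans (sym (map-∘ (upTo t)))
      (trans (map-cong e (upTo t)) (trans (map-∘ (upTo t)) (cong (map (c ∷_)) (map-∘ (upTo t))))))

  concatMap-range-1 : ∀ (H H′ : ℕ → List (List ℕ)) t → (∀ x → H (suc (suc x)) ≡ map (0 ∷_) (H′ (suc x))) →
                      concatMap H (range 1 (suc t)) ≡ H 1 ++ map (0 ∷_) (concatMap H′ (range 1 t))
  concatMap-range-1 H H′ t e =
    trans (cong (concatMap H) (range-1-suc t)) (cong (H 1 ++_)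
      (trans (concatMap-map H suc (range 1 t))
      (trans (concatMap-map (λ i → H (suc i)) (1 +_) (upTo t))
      (trans (concatMap-cong e (upTo t))
             (sym (trans (map-concatMap (0 ∷_) H′ (range 1 t)) (concatMap-map (λ i → map (0 ∷_) (H′ i)) (1 +_) (upTo t))))))))

  ↭-interchange : ∀ {A : Set} (a b c d : List A) → (a ++ b) ++ (c ++ d) ↭ (a ++ c) ++ (b ++ d)
  ↭-interchange a b c d =
    ↭-trans (↭-reflexive (++-assoc a b (c ++ d)))
            (↭-trans (++⁺ˡ a (shifts b c)) (↭-reflexive (sym (++-assoc a c (b ++ d)))))

  -- Passing from D_n to D_{n+1}, n = m + 3: every family of D_{n+1} consists
  -- of its members with α₁-coefficient 1 followed by the same family of D_n,
  -- shifted by one coordinate; and the members with α₁-coefficient 1 are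
  -- those of D_n with α₁+α₂ in front, plus α₁ and the highest root.
  module Shift (m : ℕ) where
    n′ = suc (suc m)
    n  = suc n′

    shift₁ : family₁ (suc n) ≡ lead₁ (suc n) ++ map (0 ∷_) (family₁ n)
    shift₁ = concatMap-range-1 F F′ n′ (λ x →
      trans (cong (map (λ j → mkRoot (suc n) (ind (suc (suc x)) j))) (range-suc (suc x) n′))
            (map-suc-shift _ _ 0 (range (suc x) n′)
              (λ j → trans (mkRoot-suc n _) (cong (0 ∷_) (mkRoot-cong n _ _ (λ p → ind-suc (suc x) j (suc p)))))))
      where
      F F′ : ℕ → List (List ℕ)
      F  i = map (λ j → mkRoot (suc n) (ind i j)) (range i n)
      F′ i = map (λ j → mkRoot n (ind i j)) (range i n′)

    shift₂ : family₂ (suc n) ≡ map (0 ∷_) (family₂ n)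
    shift₂ = cong (_∷ []) (trans (mkRoot-suc n (ind (suc n) (suc n)))
                                 (cong (0 ∷_) (mkRoot-cong n _ _ (λ p → ind-suc n n (suc p)))))

    shift₃ : family₃ (suc n) ≡ lead₃ (suc n) ∷ map (0 ∷_) (family₃ n)
    shift₃ = trans (cong (map f) (range-1-suc (suc m))) (cong (f 1 ∷_) (map-suc-shift⁺ f f′ 0 (suc m)
      (λ x → trans (mkRoot-suc n _) (cong (0 ∷_) (mkRoot-cong n _ _
               (λ q → cong₂ _+_ (ind-suc (suc x) (suc m) (suc q)) (ind-suc n n (suc q))))))))
      where
      f f′ : ℕ → List ℕ
      f  i = mkRoot (suc n) (λ p → ind i n′ p + ind (suc n) (suc n) p)
      f′ i = mkRoot n (λ p → ind i (suc m) p + ind n n p)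

    shift₄ : family₄ (suc n) ≡ lead₄ (suc n) ∷ map (0 ∷_) (family₄ n)
    shift₄ = trans (cong (map f) (range-1-suc (suc m))) (cong (f 1 ∷_) (map-suc-shift⁺ f f′ 0 (suc m)
      (λ x → trans (mkRoot-suc n _) (cong (0 ∷_) (mkRoot-cong n _ _
               (λ q → cong₂ _+_ (cong₂ _+_ (ind-suc (suc x) (suc m) (suc q)) (ind-suc n′ n′ (suc q))) (ind-suc n n (suc q))))))))
      where
      f f′ : ℕ → List ℕ
      f  i = mkRoot (suc n) (λ p → ind i n′ p + ind n n p + ind (suc n) (suc n) p)
      f′ i = mkRoot n (λ p → ind i (suc m) p + ind n′ n′ p + ind n n p)

    h h′ : ℕ → ℕ → List ℕ
    h  i j = mkRoot (suc n) (λ p → ind i (j ∸ 1) p + 2 * ind j n′ p + ind n n p + ind (suc n) (suc n) p)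
    h′ i j = mkRoot n (λ p → ind i (j ∸ 1) p + 2 * ind j (suc m) p + ind n′ n′ p + ind n n p)

    shift₅ : family₅ (suc n) ≡ lead₅ (suc n) ++ map (0 ∷_) (family₅ n)
    shift₅ = concatMap-range-1 (λ i → map (h i) (range (suc i) n′)) (λ i → map (h′ i) (range (suc i) (suc m))) (suc m) (λ x →
      trans (cong (map (h (suc (suc x)))) (range-suc (suc (suc x)) (suc m)))
      (trans (sym (map-∘ (range (suc (suc x)) (suc m))))
      (trans (sym (map-∘ (upTo (suc (suc m) ∸ suc (suc x)))))
      (trans (map-cong (λ z → trans (mkRoot-suc n _) (cong (0 ∷_) (mkRoot-cong n _ _ (λ q →
                cong₂ _+_ (cong₂ _+_ (cong₂ _+_ (ind-suc (suc x) (suc (x + z)) (suc q))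
                                                (cong (2 *_) (ind-suc (suc (suc (x + z))) (suc m) (suc q))))
                                     (ind-suc n′ n′ (suc q)))
                          (ind-suc n n (suc q))))))
                (upTo (suc (suc m) ∸ suc (suc x))))
      (trans (map-∘ (upTo (suc (suc m) ∸ suc (suc x)))) (cong (map (0 ∷_)) (map-∘ (upTo (suc (suc m) ∸ suc (suc x))))))))))

    -- the highest root of D_{n+1}, which is also the first root of family 5 (i = 1, j = 2)
    highest : ℕ → ℕ
    highest p = ind 1 1 p + 2 * ind 2 n′ p + ind n n p + ind (suc n) (suc n) p

    highest-tail : mkRoot n (λ p → highest (suc p)) ≡ highTail (suc m)
    highest-tail =
      trans (mkRoot-cong n _ _ (λ p →
               cong₂ _+_ (cong₂ _+_ (cong (2 *_) (ind-suc 1 (suc m) (suc p))) (ind-suc n′ n′ (suc p))) (ind-suc n n (suc p))))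
            (highTail-mkRoot (suc m))

    highestRoot-suc : highestRoot (suc n) ≡ 1 ∷ highTail (suc m)
    highestRoot-suc = trans (mkRoot-suc n _) (cong (1 ∷_) highest-tail)

    lead₁-suc : lead₁ (suc n) ≡ (1 ∷ zeros n) ∷ map (1 ∷_) (lead₁ n)
    lead₁-suc = trans (cong (map (λ j → mkRoot (suc n) (ind 1 j))) (range-1-suc n′)) (cong₂ _∷_
      (trans (mkRoot-suc n (ind 1 1)) (cong (1 ∷_) (trans (mkRoot-cong n _ (λ _ → 0) (λ _ → refl)) (mkRoot-0 n))))
      (map-suc-shift _ _ 1 (range 1 n′)
         (λ j → trans (mkRoot-suc n (ind 1 (suc j))) (cong (1 ∷_) (mkRoot-cong n _ _ (λ p → ind-1-suc j p))))))

    lead₃-suc : lead₃ (suc n) ≡ 1 ∷ lead₃ n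
    lead₃-suc = trans (mkRoot-suc n _) (cong (1 ∷_) (mkRoot-cong n _ _
      (λ q → cong₂ _+_ (ind-1-suc (suc m) q) (ind-suc n n (suc q)))))

    lead₄-suc : lead₄ (suc n) ≡ 1 ∷ lead₄ n
    lead₄-suc = trans (mkRoot-suc n _) (cong (1 ∷_) (mkRoot-cong n _ _
      (λ q → cong₂ _+_ (cong₂ _+_ (ind-1-suc (suc m) q) (ind-suc n′ n′ (suc q))) (ind-suc n n (suc q)))))

    lead₅-suc : lead₅ (suc n) ≡ (1 ∷ highTail (suc m)) ∷ map (1 ∷_) (lead₅ n)
    lead₅-suc = trans (cong (map (h 1)) (trans (range-suc 1 (suc m)) (cong (map suc) (range-1-suc m))))
      (cong₂ _∷_ (trans (mkRoot-suc n _) (cong (1 ∷_) highest-tail))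
                 (trans (sym (map-∘ (map suc (range 1 m))))
                 (trans (sym (map-∘ (range 1 m)))
                 (trans (map-cong (λ y → trans (mkRoot-suc n _) (cong (1 ∷_) (mkRoot-cong n _ _ (λ q →
                           cong₂ _+_ (cong₂ _+_ (cong₂ _+_ (ind-1-suc y q) (cong (2 *_) (ind-suc (suc y) (suc m) (suc q))))
                                                (ind-suc n′ n′ (suc q)))
                                     (ind-suc n n (suc q)))))) (range 1 m))
                 (trans (map-∘ (range 1 m))
                        (cong (map (1 ∷_)) (trans (map-∘ (range 1 m)) (cong (map (h′ 1)) (sym (range-suc 1 m))))))))))

    posRoots-split : posRoots (suc n) ↭ leadRoots (suc n) ++ map (0 ∷_) (posRoots n)
    posRoots-split =
      begin
        posRoots (suc n)
      ≡⟨ cong₂ _++_ shift₁ (cong₂ _++_ shift₂ (cong₂ _++_ shift₃ (cong₂ _++_ shift₄ shift₅))) ⟩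
        (L₁ ++ M₁) ++ (M₂ ++ ((c₃ ∷ []) ++ M₃) ++ ((c₄ ∷ []) ++ M₄) ++ (L₅ ++ M₅))
      ↭⟨ ++⁺ˡ (L₁ ++ M₁) (++⁺ˡ M₂ (++⁺ˡ ((c₃ ∷ []) ++ M₃) (↭-interchange (c₄ ∷ []) M₄ L₅ M₅))) ⟩
        (L₁ ++ M₁) ++ (M₂ ++ ((c₃ ∷ []) ++ M₃) ++ ((c₄ ∷ L₅) ++ (M₄ ++ M₅)))
      ↭⟨ ++⁺ˡ (L₁ ++ M₁) (++⁺ˡ M₂ (↭-interchange (c₃ ∷ []) M₃ (c₄ ∷ L₅) (M₄ ++ M₅))) ⟩
        (L₁ ++ M₁) ++ (M₂ ++ (c₃ ∷ c₄ ∷ L₅) ++ (M₃ ++ M₄ ++ M₅))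
      ↭⟨ ++⁺ˡ (L₁ ++ M₁) (shifts M₂ (c₃ ∷ c₄ ∷ L₅)) ⟩
        (L₁ ++ M₁) ++ ((c₃ ∷ c₄ ∷ L₅) ++ (M₂ ++ M₃ ++ M₄ ++ M₅))
      ↭⟨ ↭-interchange L₁ M₁ (c₃ ∷ c₄ ∷ L₅) (M₂ ++ M₃ ++ M₄ ++ M₅) ⟩
        leadRoots (suc n) ++ (M₁ ++ M₂ ++ M₃ ++ M₄ ++ M₅)
      ≡⟨ cong (leadRoots (suc n) ++_) (sym (shifted-families)) ⟩
        leadRoots (suc n) ++ map (0 ∷_) (posRoots n)
      ∎
      where
      open PermutationReasoning
      L₁ = lead₁ (suc n)
      c₃ = lead₃ (suc n)
      c₄ = lead₄ (suc n)
      L₅ = lead₅ (suc n)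
      M₁ = map (0 ∷_) (family₁ n)
      M₂ = map (0 ∷_) (family₂ n)
      M₃ = map (0 ∷_) (family₃ n)
      M₄ = map (0 ∷_) (family₄ n)
      M₅ = map (0 ∷_) (family₅ n)
      shifted-families : map (0 ∷_) (posRoots n) ≡ M₁ ++ M₂ ++ M₃ ++ M₄ ++ M₅
      shifted-families =
        trans (map-++ (0 ∷_) (family₁ n) _) (cong (M₁ ++_)
        (trans (map-++ (0 ∷_) (family₂ n) _) (cong (M₂ ++_)
        (trans (map-++ (0 ∷_) (family₃ n) _) (cong (M₃ ++_) (map-++ (0 ∷_) (family₄ n) _))))))

    leadRoots-suc : leadRoots (suc n) ↭ (1 ∷ zeros n) ∷ (1 ∷ highTail (suc m)) ∷ map (1 ∷_) (leadRoots n)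
    leadRoots-suc =
      begin
        leadRoots (suc n)
      ≡⟨ cong₂ _++_ lead₁-suc (cong₂ _∷_ lead₃-suc (cong₂ _∷_ lead₄-suc lead₅-suc)) ⟩
        a ∷ (b₁ ++ c₃ ∷ c₄ ∷ y ∷ b₅)
      ↭⟨ prep a move-y ⟩
        a ∷ y ∷ (b₁ ++ c₃ ∷ c₄ ∷ b₅)
      ≡⟨ cong (λ t → a ∷ y ∷ t) (sym (map-++ (1 ∷_) (lead₁ n) (lead₃ n ∷ lead₄ n ∷ lead₅ n))) ⟩
        a ∷ y ∷ map (1 ∷_) (leadRoots n)
      ∎
      where
      open PermutationReasoning
      a  = 1 ∷ zeros n
      y  = 1 ∷ highTail (suc m)
      b₁ = map (1 ∷_) (lead₁ n)
      c₃ = 1 ∷ lead₃ n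
      c₄ = 1 ∷ lead₄ n
      b₅ = map (1 ∷_) (lead₅ n)
      move-y : b₁ ++ c₃ ∷ c₄ ∷ y ∷ b₅ ↭ y ∷ (b₁ ++ c₃ ∷ c₄ ∷ b₅)
      move-y = ↭-trans (↭-reflexive (sym (++-assoc b₁ (c₃ ∷ c₄ ∷ []) (y ∷ b₅))))
                       (↭-trans (shift y (b₁ ++ c₃ ∷ c₄ ∷ []) b₅) (↭-reflexive (cong (y ∷_) (++-assoc b₁ (c₃ ∷ c₄ ∷ []) b₅))))

  -- Tails of the roots of D_{m+3} with α₁-coefficient 1 (lists of length m+2):
  -- for D₃ = A₃ these are the tails of α₁, α₁+α₂, α₁+α₃, α₁+α₂+α₃; passing to
  -- D_{m+4} adds α₁ and the highest root, and puts α₂ into all previous ones.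
  leadTails : ℕ → List (List ℕ)
  leadTails zero    = (0 ∷ 0 ∷ []) ∷ (1 ∷ 0 ∷ []) ∷ (0 ∷ 1 ∷ []) ∷ (1 ∷ 1 ∷ []) ∷ []
  leadTails (suc m) = zeros (suc (suc (suc m))) ∷ highTail (suc m) ∷ map (1 ∷_) (leadTails m)

  mutual
    -- the positive roots of D_{m+3}, sorted by their α₁-coefficient
    rootsD : ℕ → List (List ℕ)
    rootsD m = layered (leadTails m) (rootsD↓ m)

    -- the positive roots of D_{m+2}, where D₂ = A₁ × A₁
    rootsD↓ : ℕ → List (List ℕ)
    rootsD↓ zero    = (1 ∷ 0 ∷ []) ∷ (0 ∷ 1 ∷ []) ∷ []
    rootsD↓ (suc m) = rootsD m

  leadRoots-sorted : ∀ m → leadRoots (suc (suc (suc m))) ↭ map (1 ∷_) (leadTails m)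
  leadRoots-sorted zero    = ↭-refl
  leadRoots-sorted (suc m) =
    ↭-trans (Shift.leadRoots-suc m) (prep _ (prep _ (↭-map⁺ (1 ∷_) (leadRoots-sorted m))))

  posRoots-sorted : ∀ m → posRoots (suc (suc (suc m))) ↭ rootsD m
  posRoots-sorted zero    = prep _ (prep _ (shifts (mkRoot 3 (ind 2 2) ∷ mkRoot 3 (ind 3 3) ∷ []) (lead₃ 3 ∷ lead₄ 3 ∷ []) {[]}))
  posRoots-sorted (suc m) =
    ↭-trans (Shift.posRoots-split m)
            (↭-++⁺ (leadRoots-sorted (suc m)) (↭-map⁺ (0 ∷_) (posRoots-sorted m)))

  when-zeros : ∀ n v (F : List ℕ → ℕ) → when (leV (zeros n) v) (F (subV v (zeros n))) ≡ F v
  when-zeros n v F = trans (cong (λ b → when b (F (subV v (zeros n)))) (leV-zeros n v)) (cong F (subV-zeros v n))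

  when-self : ∀ v (F : List ℕ → ℕ) → when (leV v v) (F (subV v v)) ≡ F (zeros (length v))
  when-self v F = trans (cong (λ b → when b (F (subV v v))) (leV-refl v)) (cong F (subV-self v))

  -- The three counting sequences of the recursion (k = number of parts):
  --   P m k: partitions of the highest root 1 ∷ highTail (m+1) of D_{m+4};
  --   Φ m k: partitions of highTail (m+1) = 2α₁+…+2α_{m+1}+α_{m+2}+α_{m+3} in D_{m+3};
  --   Γ m k: partitions of the highest root of D_{m+4} into k+1 parts whose
  --          part with α₁-coefficient 1 contains α₂ but is not the highest root.
  P Φ Γ : ℕ → ℕ → ℕ
  P m k = count (rootsD (suc m)) (1 ∷ highTail (suc m)) k
  Φ m k = count (rootsD m) (highTail (suc m)) k
  Γ m k = sumOver (leadTails m) (λ ρ → when (leV ρ (highTail m)) (count (rootsD m) (1 ∷ subV (highTail m) ρ) k))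

  count-zeros : ∀ m k → count (rootsD m) (zeros (suc (suc (suc m)))) k ≡ δ k
  count-zeros zero    k =
    trans (count-layered-0 (leadTails zero) (rootsD↓ zero) (0 ∷ 0 ∷ []) k)
          (trans (count-layered-0 ((0 ∷ []) ∷ []) ((1 ∷ []) ∷ []) (0 ∷ []) k)
                 (count-unused (1 ∷ []) [] (0 ∷ []) k (λ _ → refl)))
  count-zeros (suc m) k = trans (count-layered-0 (leadTails (suc m)) (rootsD m) (zeros (suc (suc (suc m)))) k) (count-zeros m k)

  -- The partitions of the highest root of D_{m+4} are classified by their
  -- part with α₁-coefficient 1: α₁ (leaving highTail (m+1)), the highest root
  -- itself, or a root containing α₂ (counted by Γ).
  P-zero : ∀ m → P m 0 ≡ 0
  P-zero m = count-empty (rootsD (suc m)) (1 ∷ highTail (suc m))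

  -- with k+1 parts: α₁ leaves highTail (m+1) (Φ), the highest root leaves 0 (δ),
  -- and the remaining roots are counted by Γ
  P-suc : ∀ m k → P m (suc k) ≡ Φ m k + (δ k + Γ m k)
  P-suc m k = trans (count-layered-1 (leadTails (suc m)) (rootsD m) Y k) (cong₂ _+_ via-α₁ (cong₂ _+_ via-highest via-α₂))
    where
    Y = highTail (suc m)
    via-α₁ : when (leV (zeros (suc (suc (suc m)))) Y) (count (rootsD m) (subV Y (zeros (suc (suc (suc m))))) k) ≡ Φ m k
    via-α₁ = when-zeros (suc (suc (suc m))) Y (λ w → count (rootsD m) w k)
    via-highest : when (leV Y Y) (count (rootsD m) (subV Y Y) k) ≡ δ k
    via-highest = trans (when-self Y (λ w → count (rootsD m) w k))
                        (trans (cong (λ n → count (rootsD m) (zeros n) k) (length-highTail (suc m))) (count-zeros m k))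
    via-α₂ : sumOver (map (1 ∷_) (leadTails m)) (λ τ → when (leV τ Y) (count (rootsD m) (subV Y τ) k)) ≡ Γ m k
    via-α₂ = sumOver-map (1 ∷_) (leadTails m) _

  -- Adding α₁ to a vector with α₁-coefficient 0 and at least one part: the
  -- only usable root with α₁-coefficient 1 is α₁ itself.
  count-α₁ : ∀ m k → count (rootsD (suc m)) (1 ∷ zeros (suc (suc (suc m)))) (suc k) ≡ δ k
  count-α₁ m k =
    trans (count-layered-1 (leadTails (suc m)) (rootsD m) Z k)
          (trans (cong₂ _+_ via-α₁ (cong (0 +_) (trans (sumOver-map (1 ∷_) (leadTails m) _)
                                                         (sumOver-zero (leadTails m) (λ _ → refl)))))
                 (+-identityʳ (δ k)))
    where
    Z = zeros (suc (suc (suc m)))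
    via-α₁ : when (leV Z Z) (count (rootsD m) (subV Z Z) k) ≡ δ k
    via-α₁ = trans (when-zeros (suc (suc (suc m))) Z (λ w → count (rootsD m) w k)) (count-zeros m k)

  sumOver-lead-α₂ : ∀ m w k →
    sumOver (map (1 ∷_) (leadTails m)) (λ τ → when (leV τ (1 ∷ w)) (count (rootsD m) (subV (1 ∷ w) τ) k))
    ≡ count (rootsD m) (1 ∷ w) (suc k)
  sumOver-lead-α₂ m w k =
    trans (sumOver-map (1 ∷_) (leadTails m) _)
          (trans (sumOver-cong (leadTails m) (λ τ → when-cong (leV τ w) (count-layered-0 (leadTails m) (rootsD↓ m) (subV w τ) k)))
                 (sym (count-layered-1 (leadTails m) (rootsD↓ m) w k)))

  -- a target 1 ∷ 1 ∷ w either uses α₁ (leaving 1 ∷ w in D_{m+3} with one part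
  -- less) or a root 1 ∷ 1 ∷ τ
  count-1-1 : ∀ m w k → count (rootsD (suc m)) (1 ∷ 1 ∷ w) (suc k) ≡ count (rootsD m) (1 ∷ w) k + count (rootsD m) (1 ∷ w) (suc k)
  count-1-1 m w k = trans (count-layered-1 (leadTails (suc m)) (rootsD m) (1 ∷ w) k) (cong₂ _+_ via-α₁ (sumOver-lead-α₂ m w k))
    where
    Z = zeros (suc (suc (suc m)))
    via-α₁ : when (leV Z (1 ∷ w)) (count (rootsD m) (subV (1 ∷ w) Z) k) ≡ count (rootsD m) (1 ∷ w) k
    via-α₁ = when-zeros (suc (suc (suc m))) (1 ∷ w) (λ w → count (rootsD m) w k)

  -- Γ counts partitions into k + 1 parts, so there are none for k = 0 …
  Γ-zero : ∀ m → Γ m 0 ≡ 0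
  Γ-zero zero    = refl
  Γ-zero (suc m) = sumOver-zero (leadTails (suc m))
    (λ ρ → when-zero (leV ρ (highTail (suc m))) (count-empty (rootsD (suc m)) (1 ∷ subV (highTail (suc m)) ρ)))

  -- … and its part with α₁-coefficient 1 is α₁ + ρ with ρ one of: α₂ (leaving the
  -- count P of D_{m+4} shifted), the highest root of D_{m+4} (δ), or α₂ + τ (two Γ terms)
  Γ-suc : ∀ m k → Γ (suc m) (suc k) ≡ P m (suc k) + (δ k + (Γ m k + Γ m (suc k)))
  Γ-suc m k = cong₂ _+_ via-α₁ (cong₂ _+_ via-highest via-α₂)
    where
    Y = highTail (suc m)
    Z = zeros (suc (suc (suc m)))
    via-α₁ : when (leV Z Y) (count (rootsD (suc m)) (1 ∷ subV Y Z) (suc k)) ≡ P m (suc k)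
    via-α₁ = when-zeros (suc (suc (suc m))) Y (λ w → count (rootsD (suc m)) (1 ∷ w) (suc k))
    via-highest : when (leV Y Y) (count (rootsD (suc m)) (1 ∷ subV Y Y) (suc k)) ≡ δ k
    via-highest = trans (when-self Y (λ w → count (rootsD (suc m)) (1 ∷ w) (suc k)))
                        (trans (cong (λ n → count (rootsD (suc m)) (1 ∷ zeros n) (suc k)) (length-highTail (suc m))) (count-α₁ m k))
    via-α₂ : sumOver (map (1 ∷_) (leadTails m)) (λ ρ → when (leV ρ Y) (count (rootsD (suc m)) (1 ∷ subV Y ρ) (suc k)))
             ≡ Γ m k + Γ m (suc k)
    via-α₂ = trans (sumOver-map (1 ∷_) (leadTails m) _)
      (trans (sumOver-cong (leadTails m) (λ ρ → trans (when-cong (leV ρ (highTail m)) (count-1-1 m (subV (highTail m) ρ) k))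
                                                      (when-+ (leV ρ (highTail m)) _ _)))
             (sumOver-+ (leadTails m) _ _))

  count-1-zeros : ∀ S B n k → count (layered (map (1 ∷_) S) B) (1 ∷ zeros (suc n)) k ≡ 0
  count-1-zeros S B n zero    = count-empty (layered (map (1 ∷_) S) B) (1 ∷ zeros (suc n))
  count-1-zeros S B n (suc k) =
    trans (count-layered-1 (map (1 ∷_) S) B (zeros (suc n)) k)
          (trans (sumOver-map (1 ∷_) S _) (sumOver-zero S (λ _ → refl)))

  -- In D_{m+4} the target 2 ∷ highTail (m+1) uses α₁
  -- j ∈ {0,1,2} times: j = 0 forces the first two coordinates to be covered
  -- together (Φ m); j = 1 leaves the situation counted by P (without α₁);
  -- j = 2 leaves highTail (m+1) inside D_{m+3} (Φ m again).
  module Φ-recursion (m : ℕ) where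
    Y = highTail (suc m)
    Z = zeros (suc (suc (suc m)))
    rest₂ = layered (map (1 ∷_) (leadTails m)) (rootsD m)
    rest  = (1 ∷ Y) ∷ rest₂

    using-α₁-0 : ∀ K → countUsing (1 ∷ Z) rest (2 ∷ Y) K 0 ≡ count rest (2 ∷ Y) K
    using-α₁-0 = countUsing-zero (1 ∷ Z) rest (2 ∷ Y)

    using-α₁-1 : ∀ K → countUsing (1 ∷ Z) rest (2 ∷ Y) K 1 ≡ count rest (1 ∷ Y) (K ∸ 1)
    using-α₁-1 K = trans (countUsing-one (1 ∷ Z) rest (2 ∷ Y) K)
                         (when-zeros (suc (suc (suc m))) Y (λ w → count rest (1 ∷ w) (K ∸ 1)))

    using-α₁-2 : ∀ K → countUsing (1 ∷ Z) rest (2 ∷ Y) K 2 ≡ count rest (0 ∷ Y) (K ∸ 2)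
    using-α₁-2 K =
      trans (cong (λ s → when (leV s Y) (count rest (0 ∷ subV Y s) (K ∸ 2))) (scaleV-zeros 2 (suc (suc (suc m)))))
            (when-zeros (suc (suc (suc m))) Y (λ w → count rest (0 ∷ w) (K ∸ 2)))

    without-α₁-0 : ∀ K → count rest (0 ∷ Y) K ≡ Φ m K
    without-α₁-0 = count-layered-0 (Y ∷ map (1 ∷_) (leadTails m)) (rootsD m) Y

    -- 1 ∷ Y: either the root 1 ∷ Y itself or a root 1 ∷ 1 ∷ τ (counted by Γ)
    without-α₁-1 : ∀ k → count rest (1 ∷ Y) (suc k) ≡ δ k + Γ m k
    without-α₁-1 k = trans (count-layered-1 (Y ∷ map (1 ∷_) (leadTails m)) (rootsD m) Y k)
      (cong₂ _+_ (trans (when-self Y (λ w → count (rootsD m) w k))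
                        (trans (cong (λ n → count (rootsD m) (zeros n) k) (length-highTail (suc m))) (count-zeros m k)))
                 (sumOver-map (1 ∷_) (leadTails m) _))

    -- the root 1 ∷ Y cannot be used on 2 ∷ Y: once leaves 1 ∷ 0 ∷ … ∷ 0, twice is too much
    without-α₁-2 : ∀ K → count rest (2 ∷ Y) K ≡ Φ m K
    without-α₁-2 K = trans (count-unused (1 ∷ Y) rest₂ (2 ∷ Y) K unusable)
                           (count-equal-leads (leadTails m) (leadTails m) (rootsD↓ m) 2 (highTail m) K)
      where
      unusable : ∀ j → countUsing (1 ∷ Y) rest₂ (2 ∷ Y) K (suc j) ≡ 0
      unusable zero    = trans (countUsing-one (1 ∷ Y) rest₂ (2 ∷ Y) K)
                               (trans (when-self Y (λ w → count rest₂ (1 ∷ w) (K ∸ 1)))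
                                      (count-1-zeros (leadTails m) (rootsD m) (length (highTail m)) (K ∸ 1)))
      unusable (suc j) =
        cong (λ b → when b (count rest₂ (subV (2 ∷ Y) (scaleV (suc (suc j)) (1 ∷ Y))) (K ∸ suc (suc j))))
             (∧-zeroʳ (suc (suc j) * 1 ≤ᵇ 2))

  Φ-zero : ∀ m → Φ (suc m) 0 ≡ Φ m 0
  Φ-zero m = trans (+-identityʳ _) (trans (using-α₁-0 0) (without-α₁-2 0))
    where open Φ-recursion m

  Φ-one : ∀ m → Φ (suc m) 1 ≡ Φ m 1
  Φ-one m = trans (cong₂ _+_ (trans (using-α₁-0 1) (without-α₁-2 1))
                             (trans (+-identityʳ _) (trans (using-α₁-1 1) (count-empty rest (1 ∷ Y)))))
                  (+-identityʳ _)
    where open Φ-recursion m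

  Φ-suc-suc : ∀ m k → Φ (suc m) (suc (suc k)) ≡ Φ m (suc (suc k)) + ((δ k + Γ m k) + Φ m k)
  Φ-suc-suc m k =
    trans (count-atMost 2 (1 ∷ Z) rest (2 ∷ Y) k (λ _ → refl))
          (cong₂ _+_ (trans (using-α₁-0 K) (without-α₁-2 K))
                     (cong₂ _+_ (trans (using-α₁-1 K) (without-α₁-1 k))
                                (trans (+-identityʳ _) (trans (using-α₁-2 K) (without-α₁-0 k)))))
    where
    open Φ-recursion m
    K = suc (suc k)

  length-mkRoot : ∀ r f → length (mkRoot r f) ≡ r
  length-mkRoot r f = trans (length-map f (positions r)) (trans (length-map (1 +_) (upTo r)) (length-upTo r))

  length-posRoots : ∀ r → All (λ ρ → length ρ ≡ r) (posRoots r)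
  length-posRoots r =
    All-++⁺ (All-concat⁺ (All-map⁺ (All.universal (λ i → family (λ j → ind i j) (range i (r ∸ 1))) (range 1 (r ∸ 1)))))
    (All-++⁺ (length-mkRoot r (ind r r) ∷ᴬ []ᴬ)
    (All-++⁺ (family (λ i p → ind i (r ∸ 2) p + ind r r p) (range 1 (r ∸ 2)))
    (All-++⁺ (family (λ i p → ind i (r ∸ 2) p + ind (r ∸ 1) (r ∸ 1) p + ind r r p) (range 1 (r ∸ 2)))
             (All-concat⁺ (All-map⁺ (All.universal (λ i → family (λ j p → ind i (j ∸ 1) p + 2 * ind j (r ∸ 2) p
                                                                     + ind (r ∸ 1) (r ∸ 1) p + ind r r p)
                                                             (range (suc i) (r ∸ 2)))
                                                   (range 1 (r ∸ 2))))))))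
    where
    family : ∀ (F : ℕ → ℕ → ℕ) xs → All (λ ρ → length ρ ≡ r) (map (λ x → mkRoot r (F x)) xs)
    family F xs = All-map⁺ (All.universal (λ x → length-mkRoot r (F x)) xs)

  PCoeff-count : ∀ r k → PCoeff r (suc k) ≡ count (posRoots r) (highestRoot r) (suc k)
  PCoeff-count r k =
    enumerate-count r (posRoots r) (highestRoot r) (suc k) (suc k) (length-posRoots r) (length-mkRoot r _) ≤-refl

  PCoeff-P : ∀ m k → PCoeff (suc (suc (suc (suc m)))) k ≡ P m k
  PCoeff-P m zero    = sym (P-zero m)
  PCoeff-P m (suc k) =
    trans (PCoeff-count (suc (suc (suc (suc m)))) k)
          (trans (count-perm (posRoots-sorted (suc m)) (highestRoot (suc (suc (suc (suc m))))) (suc k))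
                 (cong (λ w → count (rootsD (suc m)) w (suc k)) (Shift.highestRoot-suc m)))

-- Power series in q are coefficient functions ℕ → ℤ, polynomials in q are
-- coefficient lists; a polynomial acts on series by multiplication.
module PolynomialAction where
  open import Data.Nat using (ℕ; zero; suc)
  open import Data.Bool using (Bool; true; false)
  open import Data.List using (List; []; _∷_; map)
  open import Data.Integer using (ℤ; +_; -[1+_]; _+_; _*_)
  open import Data.Integer.Properties using (+-identityʳ; +-identityˡ; *-zeroʳ; +-commutativeSemigroup)
  open import Data.Integer.Tactic.RingSolver using (solve-∀)
  open import Relation.Binary.PropositionalEquality
  open import Algebra.Properties.CommutativeSemigroup +-commutativeSemigroup using () renaming (interchange to +-interchange)

  q· : (ℕ → ℤ) → ℕ → ℤ
  q· f zero    = + 0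
  q· f (suc k) = f k

  infixr 6 _⊙_
  _⊙_ : List ℤ → (ℕ → ℤ) → ℕ → ℤ
  ([]     ⊙ f) k = + 0
  ((c ∷ p) ⊙ f) k = c * f k + q· (p ⊙ f) k

  _+ₚ_ : List ℤ → List ℤ → List ℤ
  []      +ₚ q       = q
  (a ∷ p) +ₚ []      = a ∷ p
  (a ∷ p) +ₚ (b ∷ q) = (a + b) ∷ (p +ₚ q)

  _·ₚ_ : ℤ → List ℤ → List ℤ
  c ·ₚ p = map (c *_) p

  _*ₚ_ : List ℤ → List ℤ → List ℤ
  []      *ₚ q = []
  (a ∷ p) *ₚ q = (a ·ₚ q) +ₚ (+ 0 ∷ (p *ₚ q))

  isZeroₚ : List ℤ → Bool
  isZeroₚ []              = true
  isZeroₚ (+ zero  ∷ p)   = isZeroₚ p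
  isZeroₚ (+ suc _ ∷ p)   = false
  isZeroₚ (-[1+ _ ] ∷ p)  = false

  q·-cong : ∀ {f g} → f ≗ g → q· f ≗ q· g
  q·-cong e zero    = refl
  q·-cong e (suc k) = e k

  q·-+ : ∀ f g k → q· (λ k → f k + g k) k ≡ q· f k + q· g k
  q·-+ f g zero    = refl
  q·-+ f g (suc k) = refl

  q·-* : ∀ c f k → q· (λ k → c * f k) k ≡ c * q· f k
  q·-* c f zero    = sym (*-zeroʳ c)
  q·-* c f (suc k) = refl

  ⊙-cong : ∀ p {f g} → f ≗ g → (p ⊙ f) ≗ (p ⊙ g)
  ⊙-cong []      e k = refl
  ⊙-cong (c ∷ p) e k = cong₂ _+_ (cong (c *_) (e k)) (q·-cong (⊙-cong p e) k)

  ⊙-+ₚ : ∀ p q f k → ((p +ₚ q) ⊙ f) k ≡ (p ⊙ f) k + (q ⊙ f) k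
  ⊙-+ₚ []      q       f k = sym (+-identityˡ _)
  ⊙-+ₚ (a ∷ p) []      f k = sym (+-identityʳ _)
  ⊙-+ₚ (a ∷ p) (b ∷ q) f k =
    trans (cong (λ z → (a + b) * f k + z) (trans (q·-cong (⊙-+ₚ p q f) k) (q·-+ (p ⊙ f) (q ⊙ f) k)))
          (distribute a b (f k) (q· (p ⊙ f) k) (q· (q ⊙ f) k))
    where
    distribute : ∀ a b x u v → (a + b) * x + (u + v) ≡ (a * x + u) + (b * x + v)
    distribute = solve-∀

  ⊙-·ₚ : ∀ c p f k → ((c ·ₚ p) ⊙ f) k ≡ c * (p ⊙ f) k
  ⊙-·ₚ c []      f k = sym (*-zeroʳ c)
  ⊙-·ₚ c (a ∷ p) f k =
    trans (cong (λ z → (c * a) * f k + z) (trans (q·-cong (⊙-·ₚ c p f) k) (q·-* c (p ⊙ f) k)))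
          (factor c a (f k) (q· (p ⊙ f) k))
    where
    factor : ∀ c a x u → (c * a) * x + c * u ≡ c * (a * x + u)
    factor = solve-∀

  ⊙-*ₚ : ∀ p q f k → ((p *ₚ q) ⊙ f) k ≡ (p ⊙ (q ⊙ f)) k
  ⊙-*ₚ []      q f k = refl
  ⊙-*ₚ (a ∷ p) q f k =
    trans (⊙-+ₚ (a ·ₚ q) (+ 0 ∷ (p *ₚ q)) f k)
          (cong₂ _+_ (⊙-·ₚ a q f k) (trans (+-identityˡ _) (q·-cong (⊙-*ₚ p q f) k)))

  ⊙-linear : ∀ p f g k → (p ⊙ (λ k → f k + g k)) k ≡ (p ⊙ f) k + (p ⊙ g) k
  ⊙-linear []      f g k = refl
  ⊙-linear (c ∷ p) f g k =
    trans (cong (λ z → c * (f k + g k) + z) (trans (q·-cong (⊙-linear p f g) k) (q·-+ (p ⊙ f) (p ⊙ g) k)))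
          (distribute c (f k) (g k) (q· (p ⊙ f) k) (q· (p ⊙ g) k))
    where
    distribute : ∀ c x y u v → c * (x + y) + (u + v) ≡ (c * x + u) + (c * y + v)
    distribute = solve-∀

  ⊙-isZero : ∀ p f k → isZeroₚ p ≡ true → (p ⊙ f) k ≡ + 0
  ⊙-isZero []             f k       _ = refl
  ⊙-isZero (+ zero ∷ p)   f zero    _ = refl
  ⊙-isZero (+ zero ∷ p)   f (suc k) e = trans (+-identityˡ _) (⊙-isZero p f k e)

  ⊙-zero : ∀ p k → (p ⊙ (λ _ → + 0)) k ≡ + 0
  ⊙-zero []      k       = refl
  ⊙-zero (c ∷ p) zero    = trans (+-identityʳ _) (*-zeroʳ c)
  ⊙-zero (c ∷ p) (suc k) = cong₂ _+_ (*-zeroʳ c) (⊙-zero p k)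

  module Transfer (φ γ : ℕ → ℕ → ℤ) (a b c d : List ℤ)
    (step-φ : ∀ m k → φ (suc m) k ≡ (a ⊙ φ m) k + (b ⊙ γ m) k)
    (step-γ : ∀ m k → γ (suc m) k ≡ (c ⊙ φ m) k + (d ⊙ γ m) k) where

    comb : ℕ → List ℤ → List ℤ → ℕ → ℤ
    comb m u w k = (u ⊙ φ m) k + (w ⊙ γ m) k

    comb-step : ∀ m u w k → comb (suc m) u w k ≡ comb m ((u *ₚ a) +ₚ (w *ₚ c)) ((u *ₚ b) +ₚ (w *ₚ d)) k
    comb-step m u w k =
      trans (cong₂ _+_ (trans (⊙-cong u (step-φ m) k) (⊙-linear u _ _ k))
                       (trans (⊙-cong w (step-γ m) k) (⊙-linear w _ _ k)))
      (trans (cong₂ _+_ (cong₂ _+_ (sym (⊙-*ₚ u a (φ m) k)) (sym (⊙-*ₚ u b (γ m) k)))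
                        (cong₂ _+_ (sym (⊙-*ₚ w c (φ m) k)) (sym (⊙-*ₚ w d (γ m) k))))
      (trans (+-interchange (((u *ₚ a) ⊙ φ m) k) (((u *ₚ b) ⊙ γ m) k) (((w *ₚ c) ⊙ φ m) k) (((w *ₚ d) ⊙ γ m) k))
             (sym (cong₂ _+_ (⊙-+ₚ (u *ₚ a) (w *ₚ c) (φ m) k) (⊙-+ₚ (u *ₚ b) (w *ₚ d) (γ m) k)))))

    comb-+ : ∀ m u w u′ w′ k → comb m u w k + comb m u′ w′ k ≡ comb m (u +ₚ u′) (w +ₚ w′) k
    comb-+ m u w u′ w′ k =
      trans (+-interchange ((u ⊙ φ m) k) ((w ⊙ γ m) k) ((u′ ⊙ φ m) k) ((w′ ⊙ γ m) k))
            (sym (cong₂ _+_ (⊙-+ₚ u u′ (φ m) k) (⊙-+ₚ w w′ (γ m) k)))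

module GeneratingFunction where
  open import Data.Nat as ℕ using (ℕ; zero; suc)
  open import Data.List using (List; []; _∷_; _++_; map; concatMap; applyUpTo; upTo; length)
  open import Data.Integer using (ℤ; +_; -[1+_]; _+_; _*_)
  open import Data.Integer.Properties using (+-identityʳ; +-identityˡ; +-assoc; *-zeroʳ; *-identityˡ; pos-+)
  open import Data.Integer.Tactic.RingSolver using (solve-∀)
  open import Relation.Binary.PropositionalEquality
  open import Data.Nat.Properties using (m≤m+n; +-suc; ≤-trans; ≤-pred; ≤-<-trans; m∸n≤m)
  open import Data.Nat.ListAction using (sum)
  open import Data.List.Relation.Unary.All using (all?)
  open import Relation.Nullary.Decidable using (toWitness)
  open Partitions using (count; count-height; PCoeff-count; PCoeff-P; map-applyUpTo; P; Φ; Γ; δ; P-zero; P-suc; Γ-zero; Γ-suc; Φ-zero; Φ-one; Φ-suc-suc)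
  open PolynomialAction

  -- the counting sequences as integer series (γ also counts the single
  -- partition of the highest root into itself, shifted by one part)
  φ γ p : ℕ → ℕ → ℤ
  φ m k = + Φ m k
  γ m k = + Γ m k + + δ k
  p m k = + P m k

  q¹ q² 1+q² 1+2q : List ℤ
  q¹   = + 0 ∷ + 1 ∷ []
  q²   = + 0 ∷ + 0 ∷ + 1 ∷ []
  1+q² = + 1 ∷ + 0 ∷ + 1 ∷ []
  1+2q = + 1 ∷ + 2 ∷ []

  q·-zero : ∀ k → q· (λ _ → + 0) k ≡ + 0
  q·-zero zero    = refl
  q·-zero (suc k) = refl

  ⊙-q¹ : ∀ f k → (q¹ ⊙ f) k ≡ q· f k
  ⊙-q¹ f zero    = refl
  ⊙-q¹ f (suc k) = trans (+-identityˡ _) (trans (cong₂ _+_ (*-identityˡ (f k)) (q·-zero k)) (+-identityʳ (f k)))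

  ⊙-q² : ∀ f k → (q² ⊙ f) k ≡ q· (q· f) k
  ⊙-q² f zero          = refl
  ⊙-q² f (suc zero)    = refl
  ⊙-q² f (suc (suc k)) = trans (+-identityˡ _) (⊙-q¹ f (suc k))

  ⊙-1+q² : ∀ f k → (1+q² ⊙ f) k ≡ f k + q· (q· f) k
  ⊙-1+q² f k = cong₂ _+_ (*-identityˡ (f k)) (q·-cong (⊙-q¹ f) k)

  ⊙-1+2q : ∀ f k → (1+2q ⊙ f) k ≡ f k + + 2 * q· f k
  ⊙-1+2q f zero    = cong₂ _+_ (*-identityˡ (f 0)) (sym (*-zeroʳ (+ 2)))
  ⊙-1+2q f (suc k) = cong₂ _+_ (*-identityˡ (f (suc k))) (trans (cong (λ z → + 2 * f k + z) (q·-zero k)) (+-identityʳ _))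

  p-series : ∀ m k → p m k ≡ q· (φ m) k + q· (γ m) k
  p-series m zero    = cong +_ (P-zero m)
  p-series m (suc k) =
    trans (cong +_ (P-suc m k))
          (trans (pos-+ (Φ m k) _) (trans (cong (λ z → φ m k + z) (pos-+ (δ k) (Γ m k))) (reorder (φ m k) (+ δ k) (+ Γ m k))))
    where
    reorder : ∀ a b c → a + (b + c) ≡ a + (c + b)
    reorder = solve-∀

  φ-series : ∀ m k → φ (suc m) k ≡ (φ m k + q· (q· (φ m)) k) + q· (q· (γ m)) k
  φ-series m zero          = trans (cong +_ (Φ-zero m)) (sym (trans (+-identityʳ _) (+-identityʳ _)))
  φ-series m (suc zero)    = trans (cong +_ (Φ-one m)) (sym (trans (+-identityʳ _) (+-identityʳ _)))
  φ-series m (suc (suc k)) =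
    trans (cong +_ (Φ-suc-suc m k))
          (trans (pos-+ (Φ m (suc (suc k))) _)
                 (trans (cong (λ z → φ m (suc (suc k)) + z) (trans (pos-+ (δ k ℕ.+ Γ m k) (Φ m k)) (cong (_+ φ m k) (pos-+ (δ k) (Γ m k)))))
                        (reorder (φ m (suc (suc k))) (+ δ k) (+ Γ m k) (φ m k))))
    where
    reorder : ∀ a b c d → a + ((b + c) + d) ≡ (a + d) + (c + b)
    reorder = solve-∀

  γ-series : ∀ m k → γ (suc m) k ≡ q· (φ m) k + (γ m k + + 2 * q· (γ m) k)
  γ-series m zero    =
    trans (cong (λ z → + z + + 1) (Γ-zero (suc m))) (cong (λ z → + 0 + ((+ z + + 1) + + 2 * + 0)) (sym (Γ-zero m)))
  γ-series m (suc k) =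
    trans (+-identityʳ _)
          (trans (cong +_ (trans (Γ-suc m k) (cong (ℕ._+ (δ k ℕ.+ (Γ m k ℕ.+ Γ m (suc k)))) (P-suc m k))))
          (trans (pos-+ (Φ m k ℕ.+ (δ k ℕ.+ Γ m k)) _)
          (trans (cong₂ _+_ (trans (pos-+ (Φ m k) _) (cong (λ z → φ m k + z) (pos-+ (δ k) (Γ m k))))
                            (trans (pos-+ (δ k) _) (cong (λ z → + δ k + z) (pos-+ (Γ m k) (Γ m (suc k))))))
                 (reorder (φ m k) (+ δ k) (+ Γ m k) (+ Γ m (suc k))))))
    where
    reorder : ∀ a b c d → (a + (b + c)) + (b + (c + d)) ≡ a + ((d + + 0) + + 2 * (c + b))
    reorder = solve-∀

  step-φ : ∀ m k → φ (suc m) k ≡ (1+q² ⊙ φ m) k + (q² ⊙ γ m) k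
  step-φ m k = trans (φ-series m k) (sym (cong₂ _+_ (⊙-1+q² (φ m) k) (⊙-q² (γ m) k)))

  step-γ : ∀ m k → γ (suc m) k ≡ (q¹ ⊙ φ m) k + (1+2q ⊙ γ m) k
  step-γ m k = trans (γ-series m k) (sym (cong₂ _+_ (⊙-q¹ (φ m) k) (⊙-1+2q (γ m) k)))

  open Transfer φ γ 1+q² q² q¹ 1+2q step-φ step-γ

  den₀ den₁ den₂ : List ℤ
  den₀ = + 1 ∷ []
  den₁ = -[1+ 1 ] ∷ -[1+ 1 ] ∷ -[1+ 0 ] ∷ []
  den₂ = + 1 ∷ + 2 ∷ + 1 ∷ + 1 ∷ []

  ⊙-p : ∀ r m k → (r ⊙ p m) k ≡ comb m (r *ₚ q¹) (r *ₚ q¹) k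
  ⊙-p r m k =
    trans (⊙-cong r (λ k → trans (p-series m k) (sym (cong₂ _+_ (⊙-q¹ (φ m) k) (⊙-q¹ (γ m) k)))) k)
          (trans (⊙-linear r _ _ k) (sym (cong₂ _+_ (⊙-*ₚ r q¹ (φ m) k) (⊙-*ₚ r q¹ (γ m) k))))

  -- Cayley–Hamilton for the transfer matrix (1+q², q²; q, 1+2q), whose trace
  -- is 2+2q+q² and whose determinant is 1+2q+q²+q³: the series p_m satisfy
  -- p_{m+2} − (2+2q+q²) p_{m+1} + (1+2q+q²+q³) p_m = 0.
  p-recurrence : ∀ m k → (den₀ ⊙ p (suc (suc m))) k + ((den₁ ⊙ p (suc m)) k + (den₂ ⊙ p m) k) ≡ + 0
  p-recurrence m k =
    begin
      (den₀ ⊙ p (suc (suc m))) k + ((den₁ ⊙ p (suc m)) k + (den₂ ⊙ p m) k)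
    ≡⟨ cong₂ _+_ (trans (⊙-p den₀ (suc (suc m)) k) (trans (comb-step (suc m) u₀ u₀ k) (comb-step m u₁ w₁ k)))
                 (cong₂ _+_ (trans (⊙-p den₁ (suc m) k) (comb-step m v₀ v₀ k)) (⊙-p den₂ m k)) ⟩
      comb m (next-φ u₁ w₁) (next-γ u₁ w₁) k + (comb m (next-φ v₀ v₀) (next-γ v₀ v₀) k + comb m t₀ t₀ k)
    ≡⟨ cong (λ z → comb m (next-φ u₁ w₁) (next-γ u₁ w₁) k + z) (comb-+ m (next-φ v₀ v₀) (next-γ v₀ v₀) t₀ t₀ k) ⟩
      comb m (next-φ u₁ w₁) (next-γ u₁ w₁) k + comb m (next-φ v₀ v₀ +ₚ t₀) (next-γ v₀ v₀ +ₚ t₀) k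
    ≡⟨ comb-+ m (next-φ u₁ w₁) (next-γ u₁ w₁) (next-φ v₀ v₀ +ₚ t₀) (next-γ v₀ v₀ +ₚ t₀) k ⟩
      comb m (next-φ u₁ w₁ +ₚ (next-φ v₀ v₀ +ₚ t₀)) (next-γ u₁ w₁ +ₚ (next-γ v₀ v₀ +ₚ t₀)) k
    ≡⟨ cong₂ _+_ (⊙-isZero (next-φ u₁ w₁ +ₚ (next-φ v₀ v₀ +ₚ t₀)) (φ m) k refl)
                 (⊙-isZero (next-γ u₁ w₁ +ₚ (next-γ v₀ v₀ +ₚ t₀)) (γ m) k refl) ⟩
      + 0
    ∎
    where
    open ≡-Reasoning
    next-φ next-γ : List ℤ → List ℤ → List ℤ
    next-φ u w = (u *ₚ 1+q²) +ₚ (w *ₚ q¹)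
    next-γ u w = (u *ₚ q²) +ₚ (w *ₚ 1+2q)
    u₀ = den₀ *ₚ q¹
    v₀ = den₁ *ₚ q¹
    t₀ = den₂ *ₚ q¹
    u₁ = next-φ u₀ u₀
    w₁ = next-γ u₀ u₀

  Σℤ-++ : ∀ xs ys → Σℤ (xs ++ ys) ≡ Σℤ xs + Σℤ ys
  Σℤ-++ []       ys = sym (+-identityˡ _)
  Σℤ-++ (x ∷ xs) ys = trans (cong (λ z → x + z) (Σℤ-++ xs ys)) (sym (+-assoc x (Σℤ xs) (Σℤ ys)))

  Σℤ-cong : ∀ {F G : ℕ → ℤ} n → (∀ i → F i ≡ G i) → Σℤ (applyUpTo F n) ≡ Σℤ (applyUpTo G n)
  Σℤ-cong zero    e = refl
  Σℤ-cong (suc n) e = cong₂ _+_ (e 0) (Σℤ-cong n (λ i → e (suc i)))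

  Σℤ-zero : ∀ {F : ℕ → ℤ} n → (∀ i → F i ≡ + 0) → Σℤ (applyUpTo F n) ≡ + 0
  Σℤ-zero zero    e = refl
  Σℤ-zero (suc n) e = cong₂ _+_ (e 0) (Σℤ-zero n (λ i → e (suc i)))

  Σℤ-concatMap : ∀ (F : ℕ → List ℤ) (G : ℕ → ℕ) n →
                 Σℤ (concatMap F (applyUpTo G n)) ≡ Σℤ (applyUpTo (λ i → Σℤ (F (G i))) n)
  Σℤ-concatMap F G zero    = refl
  Σℤ-concatMap F G (suc n) = trans (Σℤ-++ (F (G 0)) _) (cong (λ z → Σℤ (F (G 0)) + z) (Σℤ-concatMap F (λ i → G (suc i)) n))

  ⊙-as-sum : ∀ c h k → Σℤ (applyUpTo (λ j → lookup0 (+ 0) c j * h (k ℕ.∸ j)) (suc k)) ≡ (c ⊙ h) k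
  ⊙-as-sum []       h k       = Σℤ-zero (suc k) (λ _ → refl)
  ⊙-as-sum (c₀ ∷ c) h zero    = refl
  ⊙-as-sum (c₀ ∷ c) h (suc k) = cong (λ z → c₀ * h (suc k) + z) (⊙-as-sum c h k)

  polySeries-⊛ : ∀ t g r k → (polySeries t ⊛ g) r k ≡ Σℤ (applyUpTo (λ i → (lookup0 [] t i ⊙ g (r ℕ.∸ i)) k) (suc r))
  polySeries-⊛ t g r k =
    trans (Σℤ-concatMap (λ i → map (λ j → polySeries t i j * g (r ℕ.∸ i) (k ℕ.∸ j)) (upTo (suc k))) (λ i → i) (suc r))
          (Σℤ-cong (suc r) (λ i → trans (cong Σℤ (map-applyUpTo (λ j → lookup0 (+ 0) (lookup0 [] t i) j * g (r ℕ.∸ i) (k ℕ.∸ j)) (λ j → j) (suc k))) (⊙-as-sum (lookup0 [] t i) (g (r ℕ.∸ i)) k)))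

  denominator-⊛ : ∀ g m k → (denominator ⊛ g) (suc (suc m)) k
                            ≡ (den₀ ⊙ g (suc (suc m))) k + ((den₁ ⊙ g (suc m)) k + (den₂ ⊙ g m) k)
  denominator-⊛ g m k =
    trans (polySeries-⊛ (den₀ ∷ den₁ ∷ den₂ ∷ []) g (suc (suc m)) k)
          (cong (λ z → (den₀ ⊙ g (suc (suc m))) k + ((den₁ ⊙ g (suc m)) k + z))
                (trans (cong (λ z → (den₂ ⊙ g m) k + z) (Σℤ-zero m (λ _ → refl))) (+-identityʳ _)))

  ⊙-vanish : ∀ c (h : ℕ → ℤ) N → (∀ K → N ℕ.≤ K → h K ≡ + 0) → ∀ K → N ℕ.+ length c ℕ.≤ suc K → (c ⊙ h) K ≡ + 0
  ⊙-vanish []       h N h-vanish K _ = refl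
  ⊙-vanish (c₀ ∷ c) h N h-vanish K le =
    cong₂ _+_ (trans (cong (c₀ *_) (h-vanish K (≤-pred (≤-trans (ℕ.s≤s (m≤m+n N (length c))) le′)))) (*-zeroʳ c₀))
              (tail K le′)
    where
    le′ : suc (N ℕ.+ length c) ℕ.≤ suc K
    le′ = subst (ℕ._≤ suc K) (+-suc N (length c)) le
    tail : ∀ K → suc (N ℕ.+ length c) ℕ.≤ suc K → q· (c ⊙ h) K ≡ + 0
    tail zero    _  = refl
    tail (suc K) le = ⊙-vanish c h N h-vanish K (≤-pred le)

  genSeries-low : ∀ j → j ℕ.< 4 → ∀ k → genSeries j k ≡ + 0
  genSeries-low 0 _ k = refl
  genSeries-low 1 _ k = refl
  genSeries-low 2 _ k = refl
  genSeries-low 3 _ k = refl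
  genSeries-low (suc (suc (suc (suc j)))) (ℕ.s≤s (ℕ.s≤s (ℕ.s≤s (ℕ.s≤s ())))) k

  low-rank : ∀ r k → r ℕ.< 4 → (denominator ⊛ genSeries) r k ≡ + 0
  low-rank r k r<4 =
    trans (polySeries-⊛ (den₀ ∷ den₁ ∷ den₂ ∷ []) genSeries r k)
          (Σℤ-zero (suc r) (λ i → trans (⊙-cong (row i) (genSeries-low (r ℕ.∸ i) (≤-<-trans (m∸n≤m r i) r<4)) k) (⊙-zero (row i) k)))
    where
    row : ℕ → List ℤ
    row i = lookup0 [] (den₀ ∷ den₁ ∷ den₂ ∷ []) i

  -- Ranks 4 and 5: the partitions of the highest roots of D₄ and D₅ are
  -- counted explicitly; there are none with more parts than the height.
  counts : ℕ → ℕ → ℤ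
  counts r k = + count (posRoots r) (highestRoot r) k

  genSeries-4 : ∀ k → genSeries 4 k ≡ counts 4 k
  genSeries-4 zero    = refl
  genSeries-4 (suc k) = cong +_ (PCoeff-count 4 k)

  genSeries-5 : ∀ k → genSeries 5 k ≡ counts 5 k
  genSeries-5 zero    = refl
  genSeries-5 (suc k) = cong +_ (PCoeff-count 5 k)

  -- the highest roots of D₄ and D₅ have heights 5 and 7
  counts-4-vanish : ∀ K → 6 ℕ.≤ K → counts 4 K ≡ + 0
  counts-4-vanish K le = cong +_ (count-height (posRoots 4) (toWitness {a? = all? (λ ρ → 1 ℕ.≤? sum ρ) (posRoots 4)} _) (highestRoot 4) K le)

  counts-5-vanish : ∀ K → 8 ℕ.≤ K → counts 5 K ≡ + 0
  counts-5-vanish K le = cong +_ (count-height (posRoots 5) (toWitness {a? = all? (λ ρ → 1 ℕ.≤? sum ρ) (posRoots 5)} _) (highestRoot 5) K le)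

  zero-+ : ∀ a → a ≡ + 0 → a + + 0 ≡ + 0
  zero-+ a refl = refl

  rank-4-values : ∀ k → (den₀ ⊙ counts 4) k + + 0 ≡ numerator 4 k
  rank-4-values 0 = refl
  rank-4-values 1 = refl
  rank-4-values 2 = refl
  rank-4-values 3 = refl
  rank-4-values 4 = refl
  rank-4-values 5 = refl
  rank-4-values (suc (suc (suc (suc (suc (suc k)))))) =
    zero-+ _ (⊙-vanish den₀ (counts 4) 6 counts-4-vanish (suc (suc (suc (suc (suc (suc k)))))) (ℕ.s≤s (ℕ.s≤s (ℕ.s≤s (ℕ.s≤s (ℕ.s≤s (ℕ.s≤s (ℕ.s≤s ℕ.z≤n))))))))

  rank-4 : ∀ k → (denominator ⊛ genSeries) 4 k ≡ numerator 4 k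
  rank-4 k =
    trans (denominator-⊛ genSeries 2 k)
          (trans (cong₂ _+_ (⊙-cong den₀ genSeries-4 k) (cong₂ _+_ (⊙-zero den₁ k) (⊙-zero den₂ k))) (rank-4-values k))

  zero-+-zero : ∀ a b → a ≡ + 0 → b ≡ + 0 → a + (b + + 0) ≡ + 0
  zero-+-zero a b refl refl = refl

  rank-5-values : ∀ k → (den₀ ⊙ counts 5) k + ((den₁ ⊙ counts 4) k + + 0) ≡ numerator 5 k
  rank-5-values 0 = refl
  rank-5-values 1 = refl
  rank-5-values 2 = refl
  rank-5-values 3 = refl
  rank-5-values 4 = refl
  rank-5-values 5 = refl
  rank-5-values 6 = refl
  rank-5-values 7 = refl
  rank-5-values (suc (suc (suc (suc (suc (suc (suc (suc k)))))))) =
    zero-+-zero _ _ (⊙-vanish den₀ (counts 5) 8 counts-5-vanish K (ℕ.s≤s (m≤m+n 8 k)))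
                (⊙-vanish den₁ (counts 4) 6 counts-4-vanish K (ℕ.s≤s (ℕ.s≤s (m≤m+n 7 k))))
    where
    K = suc (suc (suc (suc (suc (suc (suc (suc k)))))))

  rank-5 : ∀ k → (denominator ⊛ genSeries) 5 k ≡ numerator 5 k
  rank-5 k =
    trans (denominator-⊛ genSeries 3 k)
          (trans (cong₂ _+_ (⊙-cong den₀ genSeries-5 k) (cong₂ _+_ (⊙-cong den₁ genSeries-4 k) (⊙-zero den₂ k))) (rank-5-values k))

  genSeries-p : ∀ m k → genSeries (suc (suc (suc (suc m)))) k ≡ p m k
  genSeries-p m k = cong +_ (PCoeff-P m k)

  high-rank : ∀ m k → (denominator ⊛ genSeries) (suc (suc (suc (suc (suc (suc m)))))) k ≡ + 0
  high-rank m k =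
    trans (denominator-⊛ genSeries (suc (suc (suc (suc m)))) k)
          (trans (cong₂ _+_ (⊙-cong den₀ (genSeries-p (suc (suc m))) k)
                            (cong₂ _+_ (⊙-cong den₁ (genSeries-p (suc m)) k) (⊙-cong den₂ (genSeries-p m) k)))
                 (p-recurrence m k))

open GeneratingFunction using (low-rank; rank-4; rank-5; high-rank)

theorem5p3 : (r k : ℕ) → (denominator ⊛ genSeries) r k ≡ numerator r k
theorem5p3 0 k = low-rank 0 k (s≤s z≤n)
theorem5p3 1 k = low-rank 1 k (s≤s (s≤s z≤n))
theorem5p3 2 k = low-rank 2 k (s≤s (s≤s (s≤s z≤n)))
theorem5p3 3 k = low-rank 3 k (s≤s (s≤s (s≤s (s≤s z≤n))))
theorem5p3 4 k = rank-4 k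
theorem5p3 5 k = rank-5 k
theorem5p3 (suc (suc (suc (suc (suc (suc m)))))) k = high-rank m k
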